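{- Let $\mathcal M=\mathcal M(G;r_0,r_1,r_2)$ be a regular linear hypermap and let $H=\langle r_1,r_2\rangle$. Then one of the following holds: (1) $\mathrm{Core}_G(H)=1$; (2) $\mathrm{Core}_G(H)=\langle r_2\rangle$ and either $G\cong G_1=\mathbb Z_2\times D_{2n}=\langle r_0,r_1,r_2\mid r_0^2=r_1^2=r_2^2=1,(r_0r_1)^n=(r_2r_1)^2=(r_2r_0)^2=1\rangle$ with $n\ge3$, or $G\cong G_2=D_{2m}=\langle r_0,r_1,r_2\mid r_0^2=r_1^2=(r_0r_1)^m=1,\ r_2=(r_0r_1)^{m/2}\rangle$ with $m$ even and $m\ge 6$. Moreover: if $2n=m$ and $n$ is odd, then $G_1\cong G_2$. For regular linear hypermaps in case (2): if $n$ is even, a regular linear hypermap with automorphism group $G_1$ is isomorphic to $\mathcal M_1=\mathcal M(G_1;r_0,r_1,r_2)$; if $n$ is odd, a regular linear hypermap with automorphism group $G_1$ is isomorphic to either $\mathcal M_1=\mathcal M(G_1;r_0,r_1,r_2)$ or $\mathcal M_2=\mathcal M(G_1;r_0,r_1r_2,r_2)$; for $4\mid m$, a regular linear hypermap with automorphism group $G_2$ is isomorphic to $\mathcal M_3=\mathcal M(G_2;r_0,r_1,r_2)$. If $n$ is even, $\mathcal M_1$ is orientable with $\mathcal M$-sequence $[0;2,2,n;n,n,2;4n]$. If $n$ is odd, $\mathcal M_1$ and $\mathcal M_2$ have $\mathcal M$-sequences $[0;2,2,n;n,n,2;4n]$ and $[1;2,2,2n;n,n,1;4n]$ respectively, and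 $\mathcal M_2$ is non-orientable on the projective plane. $\mathcal M_3$ is non-orientable on the projective plane with $\mathcal M$-sequence $[1;2,2,m;\frac m2,\frac m2,1;2m]$.
   Context: Let $G$ be a finite group and $r_0,r_1,r_2\in G$ pairwise distinct involutions with $G=\langle r_0,r_1,r_2\rangle$. $\mathcal M(G;r_0,r_1,r_2)$ is a regular linear hypermap if (1) $\langle r_1,r_2\rangle\cap\langle r_0,r_2\rangle=\langle r_2\rangle$ and (2) $\langle r_1,r_2\rangle\langle r_0,r_2\rangle\cap\langle r_0,r_2\rangle\langle r_1,r_2\rangle=\langle r_1,r_2\rangle\cup\langle r_0,r_2\rangle$ (products of subsets). Its flags are the elements of $G$, with $r_i$ acting by right multiplication; its automorphism group is isomorphic to $G$. Vertices, hyperedges, hyperfaces correspond to the cosets of $\langle r_1,r_2\rangle$, $\langle r_0,r_2\rangle$, $\langle r_0,r_1\rangle$ respectively, so their numbers are $V=|G|/|\langle r_1,r_2\rangle|$, $E=|G|/|\langle r_0,r_2\rangle|$, $F=|G|/|\langle r_0,r_1\rangle|$. The type is $(k,m,n)=(|r_1r_2|,|r_0r_2|,|r_0r_1|)$ (valencies of vertices, hyperedges, hyperfaces). $\mathcal M$ is non-orientable if $G=\langle r_0r_2,r_1r_2\rangle$ and orientable otherwise; its genus $g$ is determined by $V+E+F-|G|/2=2-2g$ (orientable) or $=2-g$ (non-orientable). The $\mathcal M$-sequence is $[g;k,m,n;V,E,F;|G|]$. Two such hypermaps $\mathcal M(G;r_i)$, $\mathcal M(G';s_i)$ are isomorphic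 if there is a bijection $\sigma:G\to G'$ with $(xr_i)^\sigma=x^\sigma s_i$ for all $x,i$. $\mathrm{Core}_G(H)$ is the largest normal subgroup of $G$ contained in $H$; $D_{2n}$ is the dihedral group of order $2n$. -}

module Defs where

open import Level using (0ℓ)
open import Data.Nat using (ℕ; zero; suc; _+_; _*_; _∸_; _<_; _≤_; NonZero; z≤n; s≤s; >-nonZero⁻¹)
open import Data.Nat.Properties using (+-assoc; +-comm; m∸n+n≡m; <⇒≤)
open import Data.Nat.DivMod using (_%_; _/_; m%n<n; %-distribˡ-+; m%n%n≡m%n; m<n⇒m%n≡m; n%n≡0)
open import Data.Fin using (Fin; toℕ; fromℕ<)
open import Data.Fin.Properties using (toℕ-injective; toℕ-fromℕ<; toℕ<n) renaming (_≟_ to _≟F_)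
open import Data.Bool using (Bool; true; false; _xor_; not)
open import Data.Bool.Properties using () renaming (_≟_ to _≟B_)
open import Data.Product using (Σ; ∃; _×_; _,_; proj₁; proj₂)
open import Data.Product.Properties using (≡-dec; ×-≡,≡→≡)
open import Data.Sum using (_⊎_)
open import Data.List using (List; []; _∷_; length; allFin; cartesianProduct)
open import Data.List.Membership.Propositional using (_∈_)
open import Data.List.Membership.Propositional.Properties using (∈-cartesianProduct⁺; ∈-allFin)
open import Data.List.Relation.Unary.Unique.Propositional using (Unique)
open import Data.List.Relation.Unary.Unique.Propositional.Properties using (allFin⁺; cartesianProduct⁺)
open import Data.List.Relation.Unary.Any using (here; there)
open import Data.List.Relation.Unary.AllPairs using (_∷_; [])
import Data.List.Relation.Unary.All as All
open import Relation.Binary.PropositionalEquality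
open import Relation.Binary.Definitions using (DecidableEquality)
open import Relation.Nullary using (¬_)
open import Relation.Unary using (Pred; _⊆_; _∩_; _∪_; _≐_; ｛_｝)
open import Algebra.Structures using (IsGroup; IsAbelianGroup; IsMonoid; IsSemigroup; IsMagma)
open import Algebra.Bundles using (AbelianGroup)
import Algebra.Properties.AbelianGroup as AGP
import Algebra.Properties.Group as GP

record FinGroup : Set₁ where
  infixl 7 _∙_
  infix 8 _⁻¹
  field
    Carrier  : Set
    _∙_      : Carrier → Carrier → Carrier
    ε        : Carrier
    _⁻¹      : Carrier → Carrier
    isGroup  : IsGroup _≡_ _∙_ ε _⁻¹
    _≟_      : DecidableEquality Carrier
    elements : List Carrier
    complete : ∀ x → x ∈ elements
    unique   : Unique elements

  order : ℕ
  order = length elements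

open FinGroup public using (Carrier; ε; order)

module Zmod (n : ℕ) .{{_ : NonZero n}} where

  Z : Set
  Z = Fin n

  fromℕn : ℕ → Z
  fromℕn m = fromℕ< (m%n<n m n)

  _+z_ : Z → Z → Z
  i +z j = fromℕn (toℕ i + toℕ j)

  0z : Z
  0z = fromℕn 0

  -z_ : Z → Z
  -z i = fromℕn (n ∸ toℕ i)

  private
    tf : ∀ m → toℕ (fromℕn m) ≡ m % n
    tf m = toℕ-fromℕ< (m%n<n m n)

    ft : ∀ i → fromℕn (toℕ i) ≡ i
    ft i = toℕ-injective (trans (tf (toℕ i)) (m<n⇒m%n≡m (toℕ<n i)))

    f+ : ∀ a b → fromℕn a +z fromℕn b ≡ fromℕn (a + b)
    f+ a b = toℕ-injective (begin
        toℕ (fromℕn a +z fromℕn b)        ≡⟨ tf _ ⟩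
        (toℕ (fromℕn a) + toℕ (fromℕn b)) % n ≡⟨ cong₂ (λ u v → (u + v) % n) (tf a) (tf b) ⟩
        (a % n + b % n) % n               ≡⟨ sym (%-distribˡ-+ a b n) ⟩
        (a + b) % n                       ≡⟨ sym (tf _) ⟩
        toℕ (fromℕn (a + b)) ∎)
      where open ≡-Reasoning

    f-n : fromℕn n ≡ fromℕn 0
    f-n = toℕ-injective (trans (tf n) (trans (n%n≡0 n) (sym (trans (tf 0) (m<n⇒m%n≡m (lemma))))))
      where
      lemma : 0 < n
      lemma = >-nonZero⁻¹ n

    assoc : ∀ i j k → (i +z j) +z k ≡ i +z (j +z k)
    assoc i j k = begin
      (i +z j) +z k                            ≡⟨ cong ((i +z j) +z_) (sym (ft k)) ⟩
      fromℕn (toℕ i + toℕ j) +z fromℕn (toℕ k) ≡⟨ f+ _ _ ⟩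
      fromℕn (toℕ i + toℕ j + toℕ k)           ≡⟨ cong fromℕn (+-assoc (toℕ i) _ _) ⟩
      fromℕn (toℕ i + (toℕ j + toℕ k))         ≡⟨ sym (f+ _ _) ⟩
      fromℕn (toℕ i) +z fromℕn (toℕ j + toℕ k) ≡⟨ cong (_+z (j +z k)) (ft i) ⟩
      i +z (j +z k) ∎
      where open ≡-Reasoning

    comm : ∀ i j → i +z j ≡ j +z i
    comm i j = cong fromℕn (+-comm (toℕ i) (toℕ j))

    idˡ : ∀ i → 0z +z i ≡ i
    idˡ i = trans (cong (0z +z_) (sym (ft i))) (trans (f+ 0 (toℕ i)) (ft i))

    idʳ : ∀ i → i +z 0z ≡ i
    idʳ i = trans (comm i 0z) (idˡ i)

    invˡ : ∀ i → (-z i) +z i ≡ 0z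
    invˡ i = begin
      fromℕn (n ∸ toℕ i) +z i                ≡⟨ cong (fromℕn (n ∸ toℕ i) +z_) (sym (ft i)) ⟩
      fromℕn (n ∸ toℕ i) +z fromℕn (toℕ i)   ≡⟨ f+ _ _ ⟩
      fromℕn (n ∸ toℕ i + toℕ i)             ≡⟨ cong fromℕn (m∸n+n≡m (<⇒≤ (toℕ<n i))) ⟩
      fromℕn n                               ≡⟨ f-n ⟩
      0z ∎
      where open ≡-Reasoning

    invʳ : ∀ i → i +z (-z i) ≡ 0z
    invʳ i = trans (comm i (-z i)) (invˡ i)

  isAbelianGroup : IsAbelianGroup _≡_ _+z_ 0z -z_
  isAbelianGroup = record
    { isGroup = record
      { isMonoid = record
        { isSemigroup = record
          { isMagma = record { isEquivalence = isEquivalence ; ∙-cong = cong₂ _+z_ }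
          ; assoc = assoc }
        ; identity = idˡ , idʳ }
      ; inverse = invˡ , invʳ
      ; ⁻¹-cong = cong -z_ }
    ; comm = comm }

  abelianGroup : AbelianGroup 0ℓ 0ℓ
  abelianGroup = record { isAbelianGroup = isAbelianGroup }

private
  xor-assoc : ∀ a b c → (a xor b) xor c ≡ a xor (b xor c)
  xor-assoc false b c = refl
  xor-assoc true false c = refl
  xor-assoc true true false = refl
  xor-assoc true true true = refl

  xor-idʳ : ∀ a → a xor false ≡ a
  xor-idʳ false = refl
  xor-idʳ true = refl

  xor-self : ∀ a → a xor a ≡ false
  xor-self false = refl
  xor-self true = refl

  boolList : List Bool
  boolList = true ∷ false ∷ []

  boolComplete : ∀ b → b ∈ boolList
  boolComplete true = here refl
  boolComplete false = there (here refl)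

  boolUnique : Unique boolList
  boolUnique = ((λ ()) All.∷ All.[]) ∷ All.[] ∷ []

Z₂ : FinGroup
Z₂ = record
  { Carrier = Bool ; _∙_ = _xor_ ; ε = false ; _⁻¹ = λ b → b
  ; isGroup = record
    { isMonoid = record
      { isSemigroup = record
        { isMagma = record { isEquivalence = isEquivalence ; ∙-cong = cong₂ _xor_ }
        ; assoc = xor-assoc }
      ; identity = (λ _ → refl) , xor-idʳ }
    ; inverse = xor-self , xor-self
    ; ⁻¹-cong = λ e → e }
  ; _≟_ = _≟B_ ; elements = boolList ; complete = boolComplete ; unique = boolUnique }

_⊗_ : FinGroup → FinGroup → FinGroup
G ⊗ H = record
  { Carrier = G.Carrier × H.Carrier
  ; _∙_ = λ { (a , b) (c , d) → (a G.∙ c , b H.∙ d) }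
  ; ε = (G.ε , H.ε)
  ; _⁻¹ = λ { (a , b) → (a G.⁻¹ , b H.⁻¹) }
  ; isGroup = record
    { isMonoid = record
      { isSemigroup = record
        { isMagma = record { isEquivalence = isEquivalence
                           ; ∙-cong = cong₂ (λ { (a , b) (c , d) → (a G.∙ c , b H.∙ d) }) }
        ; assoc = λ { (a , b) (c , d) (e , f) → cong₂ _,_ (IsGroup.assoc G.isGroup a c e) (IsGroup.assoc H.isGroup b d f) } }
      ; identity = (λ { (a , b) → cong₂ _,_ (IsGroup.identityˡ G.isGroup a) (IsGroup.identityˡ H.isGroup b) })
                 , (λ { (a , b) → cong₂ _,_ (IsGroup.identityʳ G.isGroup a) (IsGroup.identityʳ H.isGroup b) }) }
    ; inverse = (λ { (a , b) → cong₂ _,_ (IsGroup.inverseˡ G.isGroup a) (IsGroup.inverseˡ H.isGroup b) })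
              , (λ { (a , b) → cong₂ _,_ (IsGroup.inverseʳ G.isGroup a) (IsGroup.inverseʳ H.isGroup b) })
    ; ⁻¹-cong = cong (λ { (a , b) → (a G.⁻¹ , b H.⁻¹) }) }
  ; _≟_ = ≡-dec G._≟_ H._≟_
  ; elements = cartesianProduct G.elements H.elements
  ; complete = λ { (a , b) → ∈-cartesianProduct⁺ (G.complete a) (H.complete b) }
  ; unique = cartesianProduct⁺ G.unique H.unique }
  where
  module G = FinGroup G
  module H = FinGroup H

-- The dihedral group D_{2n} of order 2n: the pair (a , i) stands for
-- s^a ρ^i, where ρ is a rotation of order n and s a reflection
-- (s ρ s = ρ⁻¹).
module Dihedral (n : ℕ) .{{_ : NonZero n}} where
  open Zmod n public using (Z; fromℕn; _+z_; 0z; -z_)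
  private
    module A = AbelianGroup (Zmod.abelianGroup n)
    module AP = AGP (Zmod.abelianGroup n)
    module GP' = GP A.group

    tw : Bool → Z → Z
    tw false i = i
    tw true i = -z i

    tw-hom : ∀ b x y → tw b (x +z y) ≡ tw b x +z tw b y
    tw-hom false x y = refl
    tw-hom true x y = sym (AP.⁻¹-∙-comm x y)

    tw-xor : ∀ b c i → tw (b xor c) i ≡ tw c (tw b i)
    tw-xor false c i = refl
    tw-xor true false i = refl
    tw-xor true true i = sym (GP'.⁻¹-involutive i)

    tw-0 : ∀ b → tw b 0z ≡ 0z
    tw-0 false = refl
    tw-0 true = GP'.ε⁻¹≈ε

    D : Set
    D = Bool × Z

    _·_ : D → D → D
    (a , i) · (b , j) = (a xor b , tw b i +z j)

    inv : D → D
    inv (a , i) = (a , -z (tw a i))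

    e : D
    e = (false , 0z)

    assoc : ∀ x y z → (x · y) · z ≡ x · (y · z)
    assoc (a , i) (b , j) (c , k) = cong₂ _,_ (xor-assoc a b c) (begin
      tw c (tw b i +z j) +z k          ≡⟨ cong (_+z k) (tw-hom c _ _) ⟩
      (tw c (tw b i) +z tw c j) +z k   ≡⟨ A.assoc _ _ _ ⟩
      tw c (tw b i) +z (tw c j +z k)   ≡⟨ cong (_+z (tw c j +z k)) (sym (tw-xor b c i)) ⟩
      tw (b xor c) i +z (tw c j +z k)  ∎)
      where open ≡-Reasoning

    idˡ : ∀ x → e · x ≡ x
    idˡ (b , j) = cong (b ,_) (trans (cong (_+z j) (tw-0 b)) (A.identityˡ j))

    idʳ : ∀ x → x · e ≡ x
    idʳ (a , i) = cong₂ _,_ (xor-idʳ a) (A.identityʳ i)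

    invˡ : ∀ x → inv x · x ≡ e
    invˡ (false , i) = cong₂ _,_ refl (A.inverseˡ i)
    invˡ (true , i) = cong₂ _,_ refl (trans (cong (_+z i) (GP'.⁻¹-involutive (-z i))) (A.inverseˡ i))

    invʳ : ∀ x → x · inv x ≡ e
    invʳ (a , i) = cong₂ _,_ (xor-self a) (A.inverseʳ (tw a i))

  D₂ₙ : FinGroup
  D₂ₙ = record
    { Carrier = D ; _∙_ = _·_ ; ε = e ; _⁻¹ = inv
    ; isGroup = record
      { isMonoid = record
        { isSemigroup = record
          { isMagma = record { isEquivalence = isEquivalence ; ∙-cong = cong₂ _·_ }
          ; assoc = assoc }
        ; identity = idˡ , idʳ }
      ; inverse = invˡ , invʳ
      ; ⁻¹-cong = cong inv }
    ; _≟_ = ≡-dec _≟B_ _≟F_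
    ; elements = cartesianProduct boolList (allFin n)
    ; complete = λ { (a , i) → ∈-cartesianProduct⁺ (boolComplete a) (∈-allFin i) }
    ; unique = cartesianProduct⁺ boolUnique (allFin⁺ n) }

  rot : ℕ → Carrier D₂ₙ
  rot k = (false , fromℕn k)

  refl-rot : ℕ → Carrier D₂ₙ
  refl-rot k = (true , fromℕn k)

module _ (G : FinGroup) where
  open FinGroup G hiding (Carrier; ε; order)
  open FinGroup G using () renaming (Carrier to C; ε to e)

  data Span (S : Pred C 0ℓ) : Pred C 0ℓ where
    gen  : ∀ {x} → S x → Span S x
    unit : Span S e
    mul  : ∀ {x y} → Span S x → Span S y → Span S (x ∙ y)
    inv  : ∀ {x} → Span S x → Span S (x ⁻¹)

  ⟨_⟩ : List C → Pred C 0ℓ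
  ⟨ xs ⟩ = Span (_∈ xs)

  _·_ : Pred C 0ℓ → Pred C 0ℓ → Pred C 0ℓ
  (P · Q) x = ∃ λ p → ∃ λ q → P p × Q q × x ≡ p ∙ q

  𝟏 : Pred C 0ℓ
  𝟏 = ｛ e ｝

  IsNormalSubgroup : Pred C 0ℓ → Set
  IsNormalSubgroup N =
    N e × (∀ {x y} → N x → N y → N (x ∙ y)) × (∀ {x} → N x → N (x ⁻¹))
    × (∀ g {x} → N x → N (g ⁻¹ ∙ x ∙ g))

  IsCore : Pred C 0ℓ → Pred C 0ℓ → Set₁
  IsCore H K = IsNormalSubgroup K × K ⊆ H
             × (∀ (N : Pred C 0ℓ) → IsNormalSubgroup N → N ⊆ H → N ⊆ K)

  infixr 8 _^_
  _^_ : C → ℕ → C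
  x ^ zero = e
  x ^ suc k = x ∙ (x ^ k)

  HasOrder : C → ℕ → Set
  HasOrder x k = 0 < k × x ^ k ≡ e × (∀ j → 0 < j → j < k → ¬ (x ^ j ≡ e))

  HasSize : Pred C 0ℓ → ℕ → Set
  HasSize P s = Σ (List C) λ xs → Unique xs × (∀ x → (P x → x ∈ xs) × (x ∈ xs → P x))
                × length xs ≡ s

  IsIndex : Pred C 0ℓ → ℕ → Set
  IsIndex H v = Σ ℕ λ h → HasSize H h × v * h ≡ FinGroup.order G

  Involution : C → Set
  Involution r = ¬ (r ≡ e) × r ∙ r ≡ e

record RegularLinearHypermap (G : FinGroup) (r₀ r₁ r₂ : Carrier G) : Set where
  field
    inv₀ : Involution G r₀
    inv₁ : Involution G r₁
    inv₂ : Involution G r₂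
    r₀≢r₁ : ¬ (r₀ ≡ r₁)
    r₀≢r₂ : ¬ (r₀ ≡ r₂)
    r₁≢r₂ : ¬ (r₁ ≡ r₂)
    generates : ∀ x → ⟨ G ⟩ (r₀ ∷ r₁ ∷ r₂ ∷ []) x
    linear₁ : (⟨ G ⟩ (r₁ ∷ r₂ ∷ []) ∩ ⟨ G ⟩ (r₀ ∷ r₂ ∷ [])) ≐ ⟨ G ⟩ (r₂ ∷ [])
    linear₂ : ((_·_ G (⟨ G ⟩ (r₁ ∷ r₂ ∷ [])) (⟨ G ⟩ (r₀ ∷ r₂ ∷ [])))
               ∩ (_·_ G (⟨ G ⟩ (r₀ ∷ r₂ ∷ [])) (⟨ G ⟩ (r₁ ∷ r₂ ∷ []))))
              ≐ (⟨ G ⟩ (r₁ ∷ r₂ ∷ []) ∪ ⟨ G ⟩ (r₀ ∷ r₂ ∷ []))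

module _ (G : FinGroup) (r₀ r₁ r₂ : Carrier G) where
  open FinGroup G hiding (Carrier; ε; order)
  open FinGroup G using () renaming (Carrier to C; ε to e)

  NonOrientable : Set
  NonOrientable = ∀ x → ⟨ G ⟩ (r₀ ∙ r₂ ∷ r₁ ∙ r₂ ∷ []) x

  Orientable : Set
  Orientable = ¬ NonOrientable

  -- the 𝓜-sequence [g; k, m, n; V, E, F; |G|].
  -- Euler formula V + E + F - |G|/2 = 2 - 2g (orientable) / 2 - g
  -- (non-orientable), multiplied by 2 to stay in ℕ.
  record HasMSequence (g k m n V E F N : ℕ) : Set where
    field
      type-k : HasOrder G (r₁ ∙ r₂) k
      type-m : HasOrder G (r₀ ∙ r₂) m
      type-n : HasOrder G (r₀ ∙ r₁) n
      vertices   : IsIndex G (⟨ G ⟩ (r₁ ∷ r₂ ∷ [])) V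
      hyperedges : IsIndex G (⟨ G ⟩ (r₀ ∷ r₂ ∷ [])) E
      hyperfaces : IsIndex G (⟨ G ⟩ (r₀ ∷ r₁ ∷ [])) F
      flags      : FinGroup.order G ≡ N
      genus : (Orientable × 2 * (V + E + F) + 4 * g ≡ 4 + N)
            ⊎ (NonOrientable × 2 * (V + E + F) + 2 * g ≡ 4 + N)

record _≅_ (G H : FinGroup) : Set where
  private
    module G = FinGroup G
    module H = FinGroup H
  field
    to    : G.Carrier → H.Carrier
    from  : H.Carrier → G.Carrier
    from∘to : ∀ x → from (to x) ≡ x
    to∘from : ∀ y → to (from y) ≡ y
    hom   : ∀ x y → to (x G.∙ y) ≡ to x H.∙ to y

record HypermapIso (G : FinGroup) (r₀ r₁ r₂ : Carrier G)
                   (G' : FinGroup) (s₀ s₁ s₂ : Carrier G') : Set where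
  private
    module G = FinGroup G
    module G' = FinGroup G'
  field
    σ    : G.Carrier → G'.Carrier
    σ⁻¹  : G'.Carrier → G.Carrier
    σ⁻¹∘σ : ∀ x → σ⁻¹ (σ x) ≡ x
    σ∘σ⁻¹ : ∀ y → σ (σ⁻¹ y) ≡ y
    comm₀ : ∀ x → σ (x G.∙ r₀) ≡ σ x G'.∙ s₀
    comm₁ : ∀ x → σ (x G.∙ r₁) ≡ σ x G'.∙ s₁
    comm₂ : ∀ x → σ (x G.∙ r₂) ≡ σ x G'.∙ s₂

-- G₁ = ℤ₂ × D_{2n}, with r₀ = (0, s), r₁ = (0, sρ), r₂ = (1, 1);
-- so r₀² = r₁² = r₂² = (r₀r₁)ⁿ = (r₂r₁)² = (r₂r₀)² = 1.
G₁ : (n : ℕ) .{{_ : NonZero n}} → FinGroup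
G₁ n = Z₂ ⊗ Dihedral.D₂ₙ n

r₀¹ r₁¹ r₂¹ : (n : ℕ) .{{_ : NonZero n}} → Carrier (G₁ n)
r₀¹ n = (false , Dihedral.refl-rot n 0)
r₁¹ n = (false , Dihedral.refl-rot n 1)
r₂¹ n = (true , Dihedral.rot n 0)

-- G₂ = D_{2m}, with r₀ = s, r₁ = sρ, r₂ = ρ^{m/2} = (r₀r₁)^{m/2}.
G₂ : (m : ℕ) .{{_ : NonZero m}} → FinGroup
G₂ m = Dihedral.D₂ₙ m

r₀² r₁² r₂² : (m : ℕ) .{{_ : NonZero m}} → Carrier (G₂ m)
r₀² m = Dihedral.refl-rot m 0
r₁² m = Dihedral.refl-rot m 1
r₂² m = Dihedral.rot m (m / 2)

{-# OPTIONS --safe #-}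
-- Write H = ⟨r₁, r₂⟩, K = ⟨r₀, r₂⟩ and t = r₀r₁.  If x lies in a normal subgroup N ⊆ H, then
-- x r₀ = r₀ (r₀⁻¹ x r₀) lies in HK ∩ KH = H ∪ K; since r₀ ∉ H this forces x ∈ H ∩ K = ⟨r₂⟩.  So the
-- core of H is ⟨r₂⟩ when r₂ is central and 1 otherwise.
--
-- When r₂ is central, t has some order n ≥ 3 (t² = 1 would put t = r₁r₀ into HK), and s ↦ r₀, ρ ↦ t
-- is an injective homomorphism ψ : D_{2n} → G.  If r₂ is a power of t, then r₂ = t^{n/2}, linearity
-- excludes n = 4, and ψ is onto: G ≅ D_{2n}.  Otherwise (c, d) ↦ r₂ᶜ ψ(d) is an isomorphism
-- ℤ₂ × D_{2n} ≅ G.  Either way the standard generators go to r₀, r₁, r₂, which is a hypermap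
-- isomorphism.  Which case occurs for a prescribed automorphism group is decided by comparing orders
-- and exponents: ℤ₂ × D_{2n} has exponent n for n even, while D_{2m} has an element of order m.
-- For n odd, 𝓜₂ = 𝓜(G₁; r₀, r₁r₂, r₂) has t of order 2n with r₂ = tⁿ, so the first case applies to
-- it and yields ℤ₂ × D_{2n} ≅ D_{4n} together with 𝓜₂ ≅ 𝓜₃.
-- Conversely, pairwise distinct involutions with r₂ central that generate G form a regular linear
-- hypermap as soon as t ∉ ⟨r₂⟩ and t² ∉ ⟨r₂⟩, which settles the three models.
module Submission where

open import Defs
open import Level using (0ℓ)
open import Algebra.Bundles using (Group; AbelianGroup)
import Algebra.Properties.Group as GroupProperties
open import Tactic.MonoidSolver using (solve)
open import Data.Bool using (Bool; true; false; _xor_)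
open import Data.Bool.Properties using (not-involutive)
open import Data.Empty using (⊥-elim)
open import Data.Fin using (Fin; toℕ)
open import Data.Fin.Properties using (pigeonhole; any?; toℕ-fromℕ<; toℕ-injective; toℕ<n)
open import Data.List using (List; []; _∷_; lookup; map; length; cartesianProduct; allFin)
open import Data.List.Properties using (length-map; length-++; length-tabulate)
open import Data.List.Membership.Propositional using (_∈_)
open import Data.List.Membership.Propositional.Properties using (∈-map⁺; ∈-map⁻)
open import Data.List.Membership.Propositional.Properties.WithK using (unique∧set⇒bag)
open import Data.List.Relation.Binary.BagAndSetEquality using (∼bag⇒↭)
open import Data.List.Relation.Binary.Permutation.Propositional.Properties using (↭-length)
open import Data.List.Relation.Unary.All using (_∷_; [])
open import Data.List.Relation.Unary.AllPairs using (_∷_; [])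
open import Data.List.Relation.Unary.Any using (here; there; index)
open import Data.List.Relation.Unary.Any.Properties using (lookup-index)
open import Data.List.Relation.Unary.Unique.Propositional using (Unique)
import Data.List.Relation.Unary.Unique.Propositional.Properties as Unique
open import Data.Nat using (ℕ; zero; suc; _+_; _*_; _∸_; _<_; _≤_; z≤n; s≤s; NonZero; _%_; _/_;
                            >-nonZero; >-nonZero⁻¹; _<?_)
open import Data.Nat.DivMod using (m≡m%n+[m/n]*n; m%n<n; m<n⇒m%n≡m; %-distribˡ-+; m*n%n≡0; m*n/n≡m; m*[n/m]≡n)
open import Data.Nat.Divisibility using (_∣_; divides; *-cancelˡ-∣)
open import Data.Nat.Properties
  using (≤-refl; ≤-trans; ≤-pred; <⇒≤; <⇒≢; ≮⇒≥; <-cmp; m≤n⇒m<n∨m≡n; m≤m+n; m<m+n; m<n⇒0<n∸m;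
         +-identityʳ; *-identityʳ; *-identityˡ; *-assoc; *-comm; m∸n+n≡m; m+n∸n≡m; m+[n∸m]≡n; m+n≡0⇒m≡0;
         +-mono-<; +-mono-≤; +-cancelˡ-<; +-cancelʳ-<; *-cancelˡ-≡; *-cancelˡ-≤)
open import Data.Nat.Solver using (module +-*-Solver)
open +-*-Solver using (_:*_; _:+_; _:=_; con)
open import Data.Product using (Σ; ∃; ∃₂; _×_; _,_; proj₁; proj₂)
open import Data.Sum using (_⊎_; inj₁; inj₂)
open import Function.Bundles using (mk⇔)
open import Relation.Binary.Definitions using (tri<; tri≈; tri>)
open import Relation.Binary.PropositionalEquality
open import Relation.Nullary using (¬_; yes; no; Dec)
open import Relation.Nullary.Decidable using (_×-dec_)
open import Relation.Unary using (Pred; _⊆_; Decidable)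

-- Finite groups
module FinGroupProperties (G : FinGroup) where
  open FinGroup G hiding (Carrier; ε; order)
  open FinGroup G using () renaming (Carrier to C; ε to e)
  open ≡-Reasoning

  group : Group 0ℓ 0ℓ
  group = record { isGroup = isGroup }

  open Group group public using (monoid; assoc; identityˡ; identityʳ; inverseˡ; inverseʳ)
  open GroupProperties group public
    using (∙-cancelˡ; ∙-cancelʳ; inverseˡ-unique; inverseʳ-unique; ε⁻¹≈ε;
           ⁻¹-anti-homo-∙; \\-leftDividesˡ; \\-leftDividesʳ; //-rightDividesʳ)

  infixr 8 _^ᴳ_
  _^ᴳ_ : C → ℕ → C
  _^ᴳ_ = _^_ G

  Commute : C → C → Set
  Commute x y = x ∙ y ≡ y ∙ x

  IsSubgroup : Pred C 0ℓ → Set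
  IsSubgroup P = P e × (∀ {x y} → P x → P y → P (x ∙ y)) × (∀ {x} → P x → P (x ⁻¹))

  span-least : ∀ {S P} → IsSubgroup P → S ⊆ P → Span G S ⊆ P
  span-least _ S⊆P (gen s) = S⊆P s
  span-least (Pε , _) _ unit = Pε
  span-least P≤G@(_ , P∙ , _) S⊆P (mul p q) = P∙ (span-least P≤G S⊆P p) (span-least P≤G S⊆P q)
  span-least P≤G@(_ , _ , P⁻¹) S⊆P (inv p) = P⁻¹ (span-least P≤G S⊆P p)

  span-mono : ∀ {S T} → S ⊆ Span G T → Span G S ⊆ Span G T
  span-mono = span-least (unit , mul , inv)

  gen₀ : ∀ {a xs} → ⟨ G ⟩ (a ∷ xs) a
  gen₀ = gen (here refl)

  gen₁ : ∀ {a b xs} → ⟨ G ⟩ (a ∷ b ∷ xs) b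
  gen₁ = gen (there (here refl))

  gen₂ : ∀ {a b c xs} → ⟨ G ⟩ (a ∷ b ∷ c ∷ xs) c
  gen₂ = gen (there (there (here refl)))

  middle-swap : ∀ {a b c d} → Commute b c → (a ∙ b) ∙ (c ∙ d) ≡ (a ∙ c) ∙ (b ∙ d)
  middle-swap {a} {b} {c} {d} bc = begin
    (a ∙ b) ∙ (c ∙ d)   ≡⟨ solve monoid ⟩
    a ∙ (b ∙ c) ∙ d     ≡⟨ cong (λ u → a ∙ u ∙ d) bc ⟩
    a ∙ (c ∙ b) ∙ d     ≡⟨ solve monoid ⟩
    (a ∙ c) ∙ (b ∙ d)   ∎

  a∙a⁻¹xa≡xa : ∀ a x → a ∙ (a ⁻¹ ∙ x ∙ a) ≡ x ∙ a
  a∙a⁻¹xa≡xa a x = begin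
    a ∙ (a ⁻¹ ∙ x ∙ a)     ≡⟨ solve monoid ⟩
    (a ∙ a ⁻¹) ∙ (x ∙ a)   ≡⟨ cong (_∙ (x ∙ a)) (inverseʳ a) ⟩
    e ∙ (x ∙ a)            ≡⟨ identityˡ _ ⟩
    x ∙ a                  ∎

  commute-ε : ∀ x → Commute x e
  commute-ε x = trans (identityʳ x) (sym (identityˡ x))

  commute-∙ : ∀ {x y z} → Commute x y → Commute x z → Commute x (y ∙ z)
  commute-∙ {x} {y} {z} xy xz = begin
    x ∙ (y ∙ z)   ≡⟨ sym (assoc x y z) ⟩
    (x ∙ y) ∙ z   ≡⟨ cong (_∙ z) xy ⟩
    (y ∙ x) ∙ z   ≡⟨ assoc y x z ⟩
    y ∙ (x ∙ z)   ≡⟨ cong (y ∙_) xz ⟩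
    y ∙ (z ∙ x)   ≡⟨ sym (assoc y z x) ⟩
    (y ∙ z) ∙ x   ∎

  commute-⁻¹ : ∀ {x y} → Commute x y → Commute x (y ⁻¹)
  commute-⁻¹ {x} {y} xy = ∙-cancelˡ y _ _ (begin
    y ∙ (x ∙ y ⁻¹)   ≡⟨ sym (assoc y x (y ⁻¹)) ⟩
    (y ∙ x) ∙ y ⁻¹   ≡⟨ cong (_∙ y ⁻¹) (sym xy) ⟩
    (x ∙ y) ∙ y ⁻¹   ≡⟨ //-rightDividesʳ y x ⟩
    x                ≡⟨ sym (\\-leftDividesˡ y x) ⟩
    y ∙ (y ⁻¹ ∙ x)   ∎)

  centralizer-isSubgroup : ∀ x → IsSubgroup (Commute x)
  centralizer-isSubgroup x = commute-ε x , commute-∙ , commute-⁻¹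

  central-if-commutes-with-generators : ∀ {z xs} → (_∈ xs) ⊆ Commute z → (∀ g → ⟨ G ⟩ xs g) → ∀ g → Commute z g
  central-if-commutes-with-generators {z} commutes generates g = span-least (centralizer-isSubgroup z) commutes (generates g)

  ^-suc : ∀ x k → x ^ᴳ suc k ≡ x ^ᴳ k ∙ x
  ^-suc x zero = commute-ε x
  ^-suc x (suc k) = trans (cong (x ∙_) (^-suc x k)) (sym (assoc x _ x))

  ^-+ : ∀ x a b → x ^ᴳ (a + b) ≡ x ^ᴳ a ∙ x ^ᴳ b
  ^-+ x zero b = sym (identityˡ _)
  ^-+ x (suc a) b = trans (cong (x ∙_) (^-+ x a b)) (sym (assoc x _ _))

  ε^ : ∀ k → e ^ᴳ k ≡ e
  ε^ zero = refl
  ε^ (suc k) = trans (identityˡ _) (ε^ k)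

  ^-* : ∀ x a b → x ^ᴳ (a * b) ≡ (x ^ᴳ b) ^ᴳ a
  ^-* x zero b = refl
  ^-* x (suc a) b = trans (^-+ x b (a * b)) (cong (x ^ᴳ b ∙_) (^-* x a b))

  ^-2 : ∀ x → x ^ᴳ 2 ≡ x ∙ x
  ^-2 x = cong (x ∙_) (identityʳ x)

  ^≡ε⇒^*≡ε : ∀ {x n} → x ^ᴳ n ≡ e → ∀ q → x ^ᴳ (q * n) ≡ e
  ^≡ε⇒^*≡ε {x} {n} xⁿ≡ε q = trans (^-* x q n) (trans (cong (_^ᴳ q) xⁿ≡ε) (ε^ q))

  ^-% : ∀ {x n} .{{_ : NonZero n}} → x ^ᴳ n ≡ e → ∀ k → x ^ᴳ (k % n) ≡ x ^ᴳ k
  ^-% {x} {n} xⁿ≡ε k = sym (begin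
    x ^ᴳ k                                ≡⟨ cong (x ^ᴳ_) (m≡m%n+[m/n]*n k n) ⟩
    x ^ᴳ (k % n + (k / n) * n)            ≡⟨ ^-+ x (k % n) _ ⟩
    x ^ᴳ (k % n) ∙ x ^ᴳ ((k / n) * n)      ≡⟨ cong (x ^ᴳ (k % n) ∙_) (^≡ε⇒^*≡ε xⁿ≡ε (k / n)) ⟩
    x ^ᴳ (k % n) ∙ e                      ≡⟨ identityʳ _ ⟩
    x ^ᴳ (k % n)                          ∎)

  ^-⁻¹ : ∀ x k → (x ⁻¹) ^ᴳ k ≡ (x ^ᴳ k) ⁻¹
  ^-⁻¹ x zero = sym ε⁻¹≈ε
  ^-⁻¹ x (suc k) = begin
    x ⁻¹ ∙ (x ⁻¹) ^ᴳ k    ≡⟨ cong (x ⁻¹ ∙_) (^-⁻¹ x k) ⟩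
    x ⁻¹ ∙ (x ^ᴳ k) ⁻¹    ≡⟨ sym (⁻¹-anti-homo-∙ _ _) ⟩
    (x ^ᴳ k ∙ x) ⁻¹       ≡⟨ cong _⁻¹ (sym (^-suc x k)) ⟩
    (x ^ᴳ suc k) ⁻¹       ∎

  ⁻¹-^ : ∀ {x n} → x ^ᴳ n ≡ e → ∀ {i} → i ≤ n → (x ⁻¹) ^ᴳ i ≡ x ^ᴳ (n ∸ i)
  ⁻¹-^ {x} {n} xⁿ≡ε {i} i≤n = trans (^-⁻¹ x i) (sym (inverseˡ-unique _ _ (begin
    x ^ᴳ (n ∸ i) ∙ x ^ᴳ i    ≡⟨ sym (^-+ x (n ∸ i) i) ⟩
    x ^ᴳ (n ∸ i + i)        ≡⟨ cong (x ^ᴳ_) (m∸n+n≡m i≤n) ⟩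
    x ^ᴳ n                  ≡⟨ xⁿ≡ε ⟩
    e                      ∎)))

  ^-conj : ∀ {a x y} → a ∙ x ≡ y ∙ a → ∀ k → a ∙ x ^ᴳ k ≡ y ^ᴳ k ∙ a
  ^-conj {a} _ zero = commute-ε a
  ^-conj {a} {x} {y} ax≡ya (suc k) = begin
    a ∙ (x ∙ x ^ᴳ k)   ≡⟨ sym (assoc a x _) ⟩
    (a ∙ x) ∙ x ^ᴳ k   ≡⟨ cong (_∙ x ^ᴳ k) ax≡ya ⟩
    (y ∙ a) ∙ x ^ᴳ k   ≡⟨ assoc y a _ ⟩
    y ∙ (a ∙ x ^ᴳ k)   ≡⟨ cong (y ∙_) (^-conj ax≡ya k) ⟩
    y ∙ (y ^ᴳ k ∙ a)   ≡⟨ sym (assoc y _ a) ⟩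
    (y ∙ y ^ᴳ k) ∙ a   ∎

  commute-^ : ∀ {x y} → Commute x y → ∀ k → Commute x (y ^ᴳ k)
  commute-^ = ^-conj

  span-^ : ∀ {S x} → Span G S x → ∀ k → Span G S (x ^ᴳ k)
  span-^ p zero = unit
  span-^ p (suc k) = mul p (span-^ p k)

  involution-⁻¹ : ∀ {x} → x ∙ x ≡ e → x ⁻¹ ≡ x
  involution-⁻¹ {x} x²≡ε = sym (inverseʳ-unique x x x²≡ε)

  ≢-involution⇒∙≢ε : ∀ {x y} → y ∙ y ≡ e → ¬ x ≡ y → ¬ x ∙ y ≡ e
  ≢-involution⇒∙≢ε {x} {y} y²≡ε x≢y xy≡ε = x≢y (trans (inverseˡ-unique x y xy≡ε) (involution-⁻¹ y²≡ε))

  involutions-∙-⁻¹ : ∀ {x y} → x ∙ x ≡ e → y ∙ y ≡ e → (x ∙ y) ⁻¹ ≡ y ∙ x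
  involutions-∙-⁻¹ {x} {y} x²≡ε y²≡ε = trans (⁻¹-anti-homo-∙ x y) (cong₂ _∙_ (involution-⁻¹ y²≡ε) (involution-⁻¹ x²≡ε))

  involution-cancelˡ : ∀ {x} → x ∙ x ≡ e → ∀ y → x ∙ (x ∙ y) ≡ y
  involution-cancelˡ {x} x²≡ε y = trans (sym (assoc x x y)) (trans (cong (_∙ y) x²≡ε) (identityˡ y))

  involution-cancelʳ : ∀ {x} → x ∙ x ≡ e → ∀ y → (y ∙ x) ∙ x ≡ y
  involution-cancelʳ {x} x²≡ε y = trans (assoc y x x) (trans (cong (y ∙_) x²≡ε) (identityʳ y))

  span-involution : ∀ {x} → x ∙ x ≡ e → ∀ {y} → ⟨ G ⟩ (x ∷ []) y → y ≡ e ⊎ y ≡ x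
  span-involution _ (gen (here refl)) = inj₂ refl
  span-involution _ unit = inj₁ refl
  span-involution x²≡ε (mul p q) with span-involution x²≡ε p | span-involution x²≡ε q
  ... | inj₁ refl | inj₁ refl = inj₁ (identityˡ e)
  ... | inj₁ refl | inj₂ refl = inj₂ (identityˡ _)
  ... | inj₂ refl | inj₁ refl = inj₂ (identityʳ _)
  ... | inj₂ refl | inj₂ refl = inj₁ x²≡ε
  span-involution x²≡ε (inv p) with span-involution x²≡ε p
  ... | inj₁ refl = inj₁ ε⁻¹≈ε
  ... | inj₂ refl = inj₂ (involution-⁻¹ x²≡ε)

  infixr 8 _^ᵇ_
  _^ᵇ_ : C → Bool → C
  x ^ᵇ false = e
  x ^ᵇ true = x

  ^ᵇ-xor : ∀ {x} → x ∙ x ≡ e → ∀ a b → x ^ᵇ a ∙ x ^ᵇ b ≡ x ^ᵇ (a xor b)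
  ^ᵇ-xor _ false b = identityˡ _
  ^ᵇ-xor _ true false = identityʳ _
  ^ᵇ-xor x²≡ε true true = x²≡ε

  ^ᵇ-⁻¹ : ∀ {x} → x ∙ x ≡ e → ∀ b → (x ^ᵇ b) ⁻¹ ≡ x ^ᵇ b
  ^ᵇ-⁻¹ _ false = ε⁻¹≈ε
  ^ᵇ-⁻¹ x²≡ε true = involution-⁻¹ x²≡ε

  commute-^ᵇ : ∀ {x y} → Commute x y → ∀ b → Commute x (y ^ᵇ b)
  commute-^ᵇ {x} _ false = commute-ε x
  commute-^ᵇ xy true = xy

  commute-^ᵇ-^ᵇ : ∀ {x y} → Commute x y → ∀ a b → Commute (x ^ᵇ a) (y ^ᵇ b)
  commute-^ᵇ-^ᵇ {y = y} _ false b = sym (commute-ε (y ^ᵇ b))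
  commute-^ᵇ-^ᵇ xy true b = commute-^ᵇ xy b

  span-^ᵇ : ∀ {S x} → Span G S x → ∀ b → Span G S (x ^ᵇ b)
  span-^ᵇ _ false = unit
  span-^ᵇ p true = p

  involution-order : ∀ {x} → ¬ x ≡ e → x ∙ x ≡ e → HasOrder G x 2
  involution-order {x} x≢ε x²≡ε = s≤s z≤n , trans (^-2 x) x²≡ε , minimal
    where
    minimal : ∀ j → 0 < j → j < 2 → ¬ x ^ᴳ j ≡ e
    minimal 1 _ _ x¹≡ε = x≢ε (trans (sym (identityʳ x)) x¹≡ε)
    minimal (suc (suc _)) _ (s≤s (s≤s ()))

  full-size : ∀ {P} → (∀ x → P x) → HasSize G P (order G)
  full-size everything = elements , unique , (λ x → (λ _ → complete x) , (λ _ → everything x)) , refl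

  module CommutingInvolutions {x y} (x²≡ε : x ∙ x ≡ e) (y²≡ε : y ∙ y ≡ e) (xy≡yx : Commute x y) where

    NormalForm : Pred C 0ℓ
    NormalForm z = ∃₂ λ c a → z ≡ y ^ᵇ c ∙ x ^ᵇ a

    normalForm-isSubgroup : IsSubgroup NormalForm
    normalForm-isSubgroup = (false , false , sym (identityˡ e)) , closed-∙ , closed-⁻¹
      where
      closed-∙ : ∀ {z w} → NormalForm z → NormalForm w → NormalForm (z ∙ w)
      closed-∙ (c , a , refl) (c′ , a′ , refl) = c xor c′ , a xor a′ , (begin
        (y ^ᵇ c ∙ x ^ᵇ a) ∙ (y ^ᵇ c′ ∙ x ^ᵇ a′)   ≡⟨ middle-swap (commute-^ᵇ-^ᵇ xy≡yx a c′) ⟩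
        (y ^ᵇ c ∙ y ^ᵇ c′) ∙ (x ^ᵇ a ∙ x ^ᵇ a′)   ≡⟨ cong₂ _∙_ (^ᵇ-xor y²≡ε c c′) (^ᵇ-xor x²≡ε a a′) ⟩
        y ^ᵇ (c xor c′) ∙ x ^ᵇ (a xor a′)         ∎)
      closed-⁻¹ : ∀ {z} → NormalForm z → NormalForm (z ⁻¹)
      closed-⁻¹ (c , a , refl) = c , a , (begin
        (y ^ᵇ c ∙ x ^ᵇ a) ⁻¹         ≡⟨ ⁻¹-anti-homo-∙ _ _ ⟩
        (x ^ᵇ a) ⁻¹ ∙ (y ^ᵇ c) ⁻¹    ≡⟨ cong₂ _∙_ (^ᵇ-⁻¹ x²≡ε a) (^ᵇ-⁻¹ y²≡ε c) ⟩
        x ^ᵇ a ∙ y ^ᵇ c              ≡⟨ commute-^ᵇ-^ᵇ xy≡yx a c ⟩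
        y ^ᵇ c ∙ x ^ᵇ a              ∎)

    span-normalForm : ⟨ G ⟩ (x ∷ y ∷ []) ⊆ NormalForm
    span-normalForm = span-least normalForm-isSubgroup generators
      where
      generators : (_∈ x ∷ y ∷ []) ⊆ NormalForm
      generators (here refl) = false , true , sym (identityˡ x)
      generators (there (here refl)) = true , false , sym (identityʳ y)

    product-involution : (x ∙ y) ∙ (x ∙ y) ≡ e
    product-involution = begin
      (x ∙ y) ∙ (x ∙ y)   ≡⟨ middle-swap (sym xy≡yx) ⟩
      (x ∙ x) ∙ (y ∙ y)   ≡⟨ cong₂ _∙_ x²≡ε y²≡ε ⟩
      e ∙ e               ≡⟨ identityˡ e ⟩
      e                   ∎

    klein-four : ¬ x ≡ e → ¬ y ≡ e → ¬ x ≡ y → HasSize G (⟨ G ⟩ (x ∷ y ∷ [])) 4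
    klein-four x≢ε y≢ε x≢y = e ∷ y ∷ x ∷ y ∙ x ∷ [] , distinct , (λ z → listed z , spanned z) , refl
      where
      yx≢ε : ¬ y ∙ x ≡ e
      yx≢ε = ≢-involution⇒∙≢ε x²≡ε (λ y≡x → x≢y (sym y≡x))
      distinct : Unique (e ∷ y ∷ x ∷ y ∙ x ∷ [])
      distinct = ((λ ε≡y → y≢ε (sym ε≡y)) ∷ (λ ε≡x → x≢ε (sym ε≡x)) ∷ (λ ε≡yx → yx≢ε (sym ε≡yx)) ∷ [])
               ∷ ((λ y≡x → x≢y (sym y≡x)) ∷ (λ y≡yx → x≢ε (∙-cancelˡ y x e (trans (sym y≡yx) (sym (identityʳ y))))) ∷ [])
               ∷ ((λ x≡yx → y≢ε (∙-cancelʳ x y e (trans (sym x≡yx) (sym (identityˡ x))))) ∷ [])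
               ∷ [] ∷ []
      listed : ∀ z → ⟨ G ⟩ (x ∷ y ∷ []) z → z ∈ e ∷ y ∷ x ∷ y ∙ x ∷ []
      listed z s with span-normalForm s
      ... | false , false , z≡ε∙ε = here (trans z≡ε∙ε (identityˡ e))
      ... | true , false , z≡y∙ε = there (here (trans z≡y∙ε (identityʳ y)))
      ... | false , true , z≡ε∙x = there (there (here (trans z≡ε∙x (identityˡ x))))
      ... | true , true , z≡yx = there (there (there (here z≡yx)))
      spanned : ∀ z → z ∈ e ∷ y ∷ x ∷ y ∙ x ∷ [] → ⟨ G ⟩ (x ∷ y ∷ []) z
      spanned _ (here refl) = unit
      spanned _ (there (here refl)) = gen₁
      spanned _ (there (there (here refl))) = gen₀
      spanned _ (there (there (there (here refl)))) = mul gen₁ gen₀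

  module InvolutionPowerOfProduct {r₀ r₁ r₂} (r₂²≡ε : r₂ ∙ r₂ ≡ e) (r₁r₂≡r₂r₁ : Commute r₁ r₂)
                                  (generates : ∀ x → ⟨ G ⟩ (r₀ ∷ r₁ ∷ r₂ ∷ []) x)
                                  (q : ℕ) (r₂≡tᵠ : r₂ ≡ (r₀ ∙ r₁) ^ᴳ q) where

    ⟨r₀,r₁⟩-full : ∀ x → ⟨ G ⟩ (r₀ ∷ r₁ ∷ []) x
    ⟨r₀,r₁⟩-full x = span-mono generators (generates x)
      where
      generators : (_∈ r₀ ∷ r₁ ∷ r₂ ∷ []) ⊆ ⟨ G ⟩ (r₀ ∷ r₁ ∷ [])
      generators (here refl) = gen₀
      generators (there (here refl)) = gen₁
      generators (there (there (here refl))) = subst (⟨ G ⟩ _) (sym r₂≡tᵠ) (span-^ (mul gen₀ gen₁) q)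

    ⟨r₀r₂,r₁r₂⟩-full : ∀ x → ⟨ G ⟩ (r₀ ∙ r₂ ∷ r₁ ∙ r₂ ∷ []) x
    ⟨r₀r₂,r₁r₂⟩-full x = span-mono generators (generates x)
      where
      S : Pred C 0ℓ
      S = ⟨ G ⟩ (r₀ ∙ r₂ ∷ r₁ ∙ r₂ ∷ [])
      t∈S : S (r₀ ∙ r₁)
      t∈S = subst S (trans (middle-swap (sym r₁r₂≡r₂r₁)) (trans (cong ((r₀ ∙ r₁) ∙_) r₂²≡ε) (identityʳ _))) (mul gen₀ gen₁)
      r₂∈S : S r₂
      r₂∈S = subst S (sym r₂≡tᵠ) (span-^ t∈S q)
      generators : (_∈ r₀ ∷ r₁ ∷ r₂ ∷ []) ⊆ S
      generators (here refl) = subst S (involution-cancelʳ r₂²≡ε r₀) (mul gen₀ r₂∈S)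
      generators (there (here refl)) = subst S (involution-cancelʳ r₂²≡ε r₁) (mul gen₁ r₂∈S)
      generators (there (there (here refl))) = r₂∈S

least-witness-below : (P : ℕ → Set) → Decidable P → ∀ K →
                      (∃ λ n → P n × (∀ j → j < n → ¬ P j)) ⊎ (∀ j → j < K → ¬ P j)
least-witness-below P P? zero = inj₂ (λ _ ())
least-witness-below P P? (suc K) with least-witness-below P P? K
... | inj₁ least = inj₁ least
... | inj₂ none<K with P? K
...   | yes pK = inj₁ (K , pK , none<K)
...   | no ¬pK = inj₂ none≤K
  where
  none≤K : ∀ j → j < suc K → ¬ P j
  none≤K j j<1+K with m≤n⇒m<n∨m≡n (≤-pred j<1+K)
  ... | inj₁ j<K = none<K j j<K
  ... | inj₂ refl = ¬pK

least-witness : (P : ℕ → Set) → Decidable P → ∀ K → P K → ∃ λ n → P n × (∀ j → j < n → ¬ P j)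
least-witness P P? K pK with least-witness-below P P? (suc K)
... | inj₁ least = least
... | inj₂ none = ⊥-elim (none K ≤-refl pK)

module ElementOrder (G : FinGroup) where
  open FinGroup G hiding (Carrier; ε; order)
  open FinGroup G using () renaming (ε to e)
  open FinGroupProperties G

  -- Pigeonhole on x⁰, …, x^|G| gives xⁱ = xʲ with i < j.
  positive-power-ε : ∀ x → ∃ λ k → x ^ᴳ suc k ≡ e
  positive-power-ε x with pigeonhole ≤-refl (λ (i : Fin (suc (order G))) → index (complete (x ^ᴳ toℕ i)))
  ... | i , j , i<j , same-index = difference (toℕ i) (toℕ j) i<j (begin
    x ^ᴳ toℕ i                                           ≡⟨ lookup-index (complete _) ⟩
    lookup elements (index (complete (x ^ᴳ toℕ i)))     ≡⟨ cong (lookup elements) same-index ⟩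
    lookup elements (index (complete (x ^ᴳ toℕ j)))     ≡⟨ lookup-index (complete _) ⟨
    x ^ᴳ toℕ j                                           ∎)
    where
    open ≡-Reasoning
    difference : ∀ a b → a < b → x ^ᴳ a ≡ x ^ᴳ b → ∃ λ k → x ^ᴳ suc k ≡ e
    difference zero (suc b) _ ε≡xᵇ = b , sym ε≡xᵇ
    difference (suc a) (suc b) (s≤s a<b) xᵃ≡xᵇ = difference a b a<b (∙-cancelˡ x _ _ xᵃ≡xᵇ)

  order-exists : ∀ x → ∃ (HasOrder G x)
  order-exists x with positive-power-ε x
  ... | K , xᴷ⁺¹≡ε with least-witness (λ k → x ^ᴳ suc k ≡ e) (λ k → (x ^ᴳ suc k) ≟ e) K xᴷ⁺¹≡ε
  ...   | k , xᵏ⁺¹≡ε , below = suc k , s≤s z≤n , xᵏ⁺¹≡ε , minimal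
    where
    minimal : ∀ j → 0 < j → j < suc k → ¬ x ^ᴳ j ≡ e
    minimal (suc j) _ (s≤s j<k) = below j j<k

module HasOrderProperties (G : FinGroup) {x : Carrier G} {n : ℕ} (|x|≡n : HasOrder G x n) where
  open FinGroup G hiding (Carrier; ε; order)
  open FinGroup G using () renaming (ε to e)
  open FinGroupProperties G

  instance
    n-nonZero : NonZero n
    n-nonZero = >-nonZero (proj₁ |x|≡n)

  xⁿ≡ε : x ^ᴳ n ≡ e
  xⁿ≡ε = proj₁ (proj₂ |x|≡n)

  ^≡ε⇒≡0 : ∀ {i} → x ^ᴳ i ≡ e → i < n → i ≡ 0
  ^≡ε⇒≡0 {zero} _ _ = refl
  ^≡ε⇒≡0 {suc i} xⁱ≡ε i<n = ⊥-elim (proj₂ (proj₂ |x|≡n) (suc i) (s≤s z≤n) i<n xⁱ≡ε)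

  ^≡ε⇒≡0∨≡n : ∀ {k} → x ^ᴳ k ≡ e → k < n + n → k ≡ 0 ⊎ k ≡ n
  ^≡ε⇒≡0∨≡n {k} xᵏ≡ε k<2n with k <? n
  ... | yes k<n = inj₁ (^≡ε⇒≡0 xᵏ≡ε k<n)
  ... | no k≮n = inj₂ (trans (sym n+[k∸n]≡k) (trans (cong (n +_) k∸n≡0) (+-identityʳ n)))
    where
    open ≡-Reasoning
    n+[k∸n]≡k : n + (k ∸ n) ≡ k
    n+[k∸n]≡k = m+[n∸m]≡n (≮⇒≥ k≮n)
    k∸n≡0 : k ∸ n ≡ 0
    k∸n≡0 = ^≡ε⇒≡0 (∙-cancelˡ (x ^ᴳ n) _ _ (begin
      x ^ᴳ n ∙ x ^ᴳ (k ∸ n)   ≡⟨ ^-+ x n (k ∸ n) ⟨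
      x ^ᴳ (n + (k ∸ n))     ≡⟨ cong (x ^ᴳ_) n+[k∸n]≡k ⟩
      x ^ᴳ k                 ≡⟨ xᵏ≡ε ⟩
      e                      ≡⟨ xⁿ≡ε ⟨
      x ^ᴳ n                 ≡⟨ identityʳ _ ⟨
      x ^ᴳ n ∙ e             ∎))
      (+-cancelˡ-< n _ _ (subst (_< n + n) (sym n+[k∸n]≡k) k<2n))

module Homomorphism (A B : FinGroup) (φ : Carrier A → Carrier B)
                    (φ-hom : ∀ x y → φ (FinGroup._∙_ A x y) ≡ FinGroup._∙_ B (φ x) (φ y)) where
  private
    module A = FinGroup A
    module B = FinGroup B
    module PA = FinGroupProperties A
    module PB = FinGroupProperties B

  φ-ε : φ A.ε ≡ B.ε
  φ-ε = PB.∙-cancelˡ (φ A.ε) _ _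
          (trans (sym (φ-hom _ _)) (trans (cong φ (PA.identityʳ A.ε)) (sym (PB.identityʳ _))))

  φ-⁻¹ : ∀ x → φ (x A.⁻¹) ≡ φ x B.⁻¹
  φ-⁻¹ x = PB.inverseʳ-unique (φ x) _ (trans (sym (φ-hom _ _)) (trans (cong φ (PA.inverseʳ x)) φ-ε))

  φ-^ : ∀ x k → φ (x PA.^ᴳ k) ≡ φ x PB.^ᴳ k
  φ-^ x zero = φ-ε
  φ-^ x (suc k) = trans (φ-hom _ _) (cong (φ x B.∙_) (φ-^ x k))

  Image : Pred (Carrier B) 0ℓ
  Image y = ∃ λ x → φ x ≡ y

  image-isSubgroup : PB.IsSubgroup Image
  image-isSubgroup = (A.ε , φ-ε) , closed-∙ , closed-⁻¹
    where
    closed-∙ : ∀ {y z} → Image y → Image z → Image (y B.∙ z)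
    closed-∙ (a , refl) (b , refl) = a A.∙ b , φ-hom a b
    closed-⁻¹ : ∀ {y} → Image y → Image (y B.⁻¹)
    closed-⁻¹ (a , refl) = a A.⁻¹ , φ-⁻¹ a

  module Bijective (kernel-trivial : ∀ x → φ x ≡ B.ε → x ≡ A.ε) (surjective : ∀ y → Image y) where

    injective : ∀ {x y} → φ x ≡ φ y → x ≡ y
    injective {x} {y} φx≡φy = PA.∙-cancelʳ (y A.⁻¹) x y (trans (kernel-trivial _ φ[xy⁻¹]≡ε) (sym (PA.inverseʳ y)))
      where
      φ[xy⁻¹]≡ε : φ (x A.∙ y A.⁻¹) ≡ B.ε
      φ[xy⁻¹]≡ε = trans (φ-hom _ _) (trans (cong (B._∙ φ (y A.⁻¹)) φx≡φy)
                    (trans (sym (φ-hom _ _)) (trans (cong φ (PA.inverseʳ y)) φ-ε)))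

    φ⁻¹ : Carrier B → Carrier A
    φ⁻¹ y = proj₁ (surjective y)

    φ∘φ⁻¹ : ∀ y → φ (φ⁻¹ y) ≡ y
    φ∘φ⁻¹ y = proj₂ (surjective y)

    φ⁻¹∘φ : ∀ x → φ⁻¹ (φ x) ≡ x
    φ⁻¹∘φ x = injective (φ∘φ⁻¹ (φ x))

    φ⁻¹-hom : ∀ x y → φ⁻¹ (x B.∙ y) ≡ φ⁻¹ x A.∙ φ⁻¹ y
    φ⁻¹-hom x y = injective (trans (φ∘φ⁻¹ _)
                    (trans (cong₂ B._∙_ (sym (φ∘φ⁻¹ x)) (sym (φ∘φ⁻¹ y))) (sym (φ-hom _ _))))

    inverse-≅ : B ≅ A
    inverse-≅ = record { to = φ⁻¹ ; from = φ ; from∘to = φ∘φ⁻¹ ; to∘from = φ⁻¹∘φ ; hom = φ⁻¹-hom }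

    inverse-hypermapIso : ∀ {s₀ s₁ s₂ r₀ r₁ r₂} → φ s₀ ≡ r₀ → φ s₁ ≡ r₁ → φ s₂ ≡ r₂ →
                          HypermapIso B r₀ r₁ r₂ A s₀ s₁ s₂
    inverse-hypermapIso φs₀≡r₀ φs₁≡r₁ φs₂≡r₂ = record
      { σ = φ⁻¹ ; σ⁻¹ = φ ; σ⁻¹∘σ = φ∘φ⁻¹ ; σ∘σ⁻¹ = φ⁻¹∘φ
      ; comm₀ = φ⁻¹-right-action φs₀≡r₀ ; comm₁ = φ⁻¹-right-action φs₁≡r₁ ; comm₂ = φ⁻¹-right-action φs₂≡r₂ }
      where
      φ⁻¹-right-action : ∀ {s r} → φ s ≡ r → ∀ x → φ⁻¹ (x B.∙ r) ≡ φ⁻¹ x A.∙ s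
      φ⁻¹-right-action {s} refl x = trans (φ⁻¹-hom x (φ s)) (cong (φ⁻¹ x A.∙_) (φ⁻¹∘φ s))

module _ {G H : FinGroup} (i : G ≅ H) where
  private
    module G = FinGroup G
    module H = FinGroup H
  open _≅_ i

  ≅-injective : ∀ {x y} → to x ≡ to y → x ≡ y
  ≅-injective {x} {y} tx≡ty = trans (sym (from∘to x)) (trans (cong from tx≡ty) (from∘to y))

  ≅-sym : H ≅ G
  ≅-sym = record
    { to = from ; from = to ; from∘to = to∘from ; to∘from = from∘to
    ; hom = λ x y → ≅-injective (trans (to∘from _)
              (trans (cong₂ H._∙_ (sym (to∘from x)) (sym (to∘from y))) (sym (hom _ _)))) }

  ≅-order : order G ≡ order H
  ≅-order = trans (sym (length-map to G.elements)) (↭-length (∼bag⇒↭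
    (unique∧set⇒bag (Unique.map⁺ ≅-injective G.unique) H.unique (mk⇔ (λ _ → H.complete _) image))))
    where
    image : ∀ {y} → y ∈ H.elements → y ∈ map to G.elements
    image {y} _ = subst (_∈ map to G.elements) (to∘from y) (∈-map⁺ to (G.complete (from y)))

  ≅-exponent : ∀ k → (∀ y → _^_ H y k ≡ H.ε) → ∀ x → _^_ G x k ≡ G.ε
  ≅-exponent k exponent x = ≅-injective (trans (φ-^ x k) (trans (exponent (to x)) (sym φ-ε)))
    where open Homomorphism G H to hom

≅-trans : ∀ {G H K} → G ≅ H → H ≅ K → G ≅ K
≅-trans i j = record
  { to = λ x → J.to (I.to x) ; from = λ z → I.from (J.from z)
  ; from∘to = λ x → trans (cong I.from (J.from∘to _)) (I.from∘to x)
  ; to∘from = λ z → trans (cong J.to (I.to∘from _)) (J.to∘from z)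
  ; hom = λ x y → trans (cong J.to (I.hom x y)) (J.hom _ _) }
  where
  module I = _≅_ i
  module J = _≅_ j

HypermapIso-sym : ∀ {G r₀ r₁ r₂ H s₀ s₁ s₂} → HypermapIso G r₀ r₁ r₂ H s₀ s₁ s₂ → HypermapIso H s₀ s₁ s₂ G r₀ r₁ r₂
HypermapIso-sym {G = G} {H = H} h = record
  { σ = σ⁻¹ ; σ⁻¹ = σ ; σ⁻¹∘σ = σ∘σ⁻¹ ; σ∘σ⁻¹ = σ⁻¹∘σ
  ; comm₀ = σ⁻¹-right-action comm₀ ; comm₁ = σ⁻¹-right-action comm₁ ; comm₂ = σ⁻¹-right-action comm₂ }
  where
  open HypermapIso h
  module G = FinGroup G
  module H = FinGroup H
  σ⁻¹-right-action : ∀ {r s} → (∀ x → σ (x G.∙ r) ≡ σ x H.∙ s) → ∀ y → σ⁻¹ (y H.∙ s) ≡ σ⁻¹ y G.∙ r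
  σ⁻¹-right-action {r} {s} σ-comm y = begin
    σ⁻¹ (y H.∙ s)               ≡⟨ cong (λ z → σ⁻¹ (z H.∙ s)) (σ∘σ⁻¹ y) ⟨
    σ⁻¹ (σ (σ⁻¹ y) H.∙ s)       ≡⟨ cong σ⁻¹ (σ-comm (σ⁻¹ y)) ⟨
    σ⁻¹ (σ (σ⁻¹ y G.∙ r))       ≡⟨ σ⁻¹∘σ _ ⟩
    σ⁻¹ y G.∙ r                 ∎
    where open ≡-Reasoning

HypermapIso-trans : ∀ {G r₀ r₁ r₂ H s₀ s₁ s₂ K u₀ u₁ u₂} → HypermapIso G r₀ r₁ r₂ H s₀ s₁ s₂ →
                    HypermapIso H s₀ s₁ s₂ K u₀ u₁ u₂ → HypermapIso G r₀ r₁ r₂ K u₀ u₁ u₂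
HypermapIso-trans h k = record
  { σ = λ x → K.σ (I.σ x) ; σ⁻¹ = λ z → I.σ⁻¹ (K.σ⁻¹ z)
  ; σ⁻¹∘σ = λ x → trans (cong I.σ⁻¹ (K.σ⁻¹∘σ _)) (I.σ⁻¹∘σ x)
  ; σ∘σ⁻¹ = λ z → trans (cong K.σ (I.σ∘σ⁻¹ _)) (K.σ∘σ⁻¹ z)
  ; comm₀ = λ x → trans (cong K.σ (I.comm₀ x)) (K.comm₀ _)
  ; comm₁ = λ x → trans (cong K.σ (I.comm₁ x)) (K.comm₁ _)
  ; comm₂ = λ x → trans (cong K.σ (I.comm₂ x)) (K.comm₂ _) }
  where
  module I = HypermapIso h
  module K = HypermapIso k

-- Dihedral groups
length-cartesianProduct : ∀ {A B : Set} (xs : List A) (ys : List B) →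
                          length (cartesianProduct xs ys) ≡ length xs * length ys
length-cartesianProduct [] ys = refl
length-cartesianProduct (x ∷ xs) ys =
  trans (length-++ (map (x ,_) ys)) (cong₂ _+_ (length-map (x ,_) ys) (length-cartesianProduct xs ys))

module DihedralProperties (n : ℕ) .{{_ : NonZero n}} where
  open Dihedral n
  private
    module D = FinGroup D₂ₙ
    module ℤₙ = AbelianGroup (Zmod.abelianGroup n)
  open FinGroupProperties D₂ₙ
  open ≡-Reasoning

  toℕ-fromℕn : ∀ k → toℕ (fromℕn k) ≡ k % n
  toℕ-fromℕn k = toℕ-fromℕ< (m%n<n k n)

  fromℕn-toℕ : ∀ i → fromℕn (toℕ i) ≡ i
  fromℕn-toℕ i = toℕ-injective (trans (toℕ-fromℕn (toℕ i)) (m<n⇒m%n≡m (toℕ<n i)))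

  toℕ-0z : toℕ 0z ≡ 0
  toℕ-0z = trans (toℕ-fromℕn 0) (m*n%n≡0 0 n)

  fromℕn-+ : ∀ a b → fromℕn a +z fromℕn b ≡ fromℕn (a + b)
  fromℕn-+ a b = toℕ-injective (begin
    toℕ (fromℕn a +z fromℕn b)                 ≡⟨ toℕ-fromℕn _ ⟩
    (toℕ (fromℕn a) + toℕ (fromℕn b)) % n      ≡⟨ cong₂ (λ u v → (u + v) % n) (toℕ-fromℕn a) (toℕ-fromℕn b) ⟩
    (a % n + b % n) % n                        ≡⟨ %-distribˡ-+ a b n ⟨
    (a + b) % n                                ≡⟨ toℕ-fromℕn (a + b) ⟨
    toℕ (fromℕn (a + b))                       ∎)

  order-D₂ₙ : order D₂ₙ ≡ 2 * n
  order-D₂ₙ = trans (length-cartesianProduct (true ∷ false ∷ []) (allFin n)) (cong (2 *_) (length-tabulate {n = n} (λ i → i)))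

  rot-+ : ∀ a b → rot a D.∙ rot b ≡ rot (a + b)
  rot-+ a b = cong (false ,_) (fromℕn-+ a b)

  rot-^ : ∀ a k → rot a ^ᴳ k ≡ rot (k * a)
  rot-^ a zero = refl
  rot-^ a (suc k) = trans (cong (rot a D.∙_) (rot-^ a k)) (rot-+ a (k * a))

  ρ^ : ∀ k → rot 1 ^ᴳ k ≡ rot k
  ρ^ k = trans (rot-^ 1 k) (cong rot (*-identityʳ k))

  rot-toℕ : ∀ i → rot (toℕ i) ≡ (false , i)
  rot-toℕ i = cong (false ,_) (fromℕn-toℕ i)

  rot-injective : ∀ {a b} → rot a ≡ rot b → a % n ≡ b % n
  rot-injective {a} {b} eq = trans (sym (toℕ-fromℕn a)) (trans (cong (λ x → toℕ (proj₂ x)) eq) (toℕ-fromℕn b))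

  rot-≢ : ∀ {a b} → a < n → b < n → ¬ a ≡ b → ¬ rot a ≡ rot b
  rot-≢ a<n b<n a≢b eq = a≢b (trans (sym (m<n⇒m%n≡m a<n)) (trans (rot-injective eq) (m<n⇒m%n≡m b<n)))

  rot-≢ε : ∀ {k} → 0 < k → k < n → ¬ rot k ≡ D.ε
  rot-≢ε {suc k} 0<k k<n = rot-≢ k<n (>-nonZero⁻¹ n) (λ ())

  rot-* : ∀ a → rot (a * n) ≡ D.ε
  rot-* a = cong (false ,_) (toℕ-injective (trans (toℕ-fromℕn _) (trans (m*n%n≡0 a n) (sym toℕ-0z))))

  rot-n : rot n ≡ D.ε
  rot-n = trans (cong rot (sym (*-identityˡ n))) (rot-* 1)

  rot-+n : ∀ k → rot (k + n) ≡ rot k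
  rot-+n k = trans (sym (rot-+ k n)) (trans (cong (rot k D.∙_) rot-n) (identityʳ (rot k)))

  reflection-involution : ∀ i → (true , i) D.∙ (true , i) ≡ D.ε
  reflection-involution i = cong (false ,_) (ℤₙ.inverseˡ i)

  s∙sρ≡ρ : refl-rot 0 D.∙ refl-rot 1 ≡ rot 1
  s∙sρ≡ρ = cong (false ,_) (trans (cong (_+z fromℕn 1) (GroupProperties.ε⁻¹≈ε ℤₙ.group)) (ℤₙ.identityˡ _))

  s∙rot : ∀ i → refl-rot 0 D.∙ (false , i) ≡ (true , i)
  s∙rot i = cong (true ,_) (ℤₙ.identityˡ i)

  generated-by-s-ρ : ∀ d → ⟨ D₂ₙ ⟩ (refl-rot 0 ∷ rot 1 ∷ []) d
  generated-by-s-ρ (false , i) = subst (⟨ D₂ₙ ⟩ _) (trans (ρ^ (toℕ i)) (rot-toℕ i)) (span-^ gen₁ (toℕ i))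
  generated-by-s-ρ (true , i) = subst (⟨ D₂ₙ ⟩ _) (s∙rot i) (mul gen₀ (generated-by-s-ρ (false , i)))

  reflection-^-even : ∀ {k} → 2 ∣ k → ∀ i → (true , i) ^ᴳ k ≡ D.ε
  reflection-^-even (divides q refl) i = begin
    (true , i) ^ᴳ (q * 2)        ≡⟨ ^-* (true , i) q 2 ⟩
    ((true , i) ^ᴳ 2) ^ᴳ q       ≡⟨ cong (_^ᴳ q) (trans (^-2 _) (reflection-involution i)) ⟩
    D.ε ^ᴳ q                     ≡⟨ ε^ q ⟩
    D.ε                          ∎

  rotation-^-multiple : ∀ {k} → n ∣ k → ∀ i → (false , i) ^ᴳ k ≡ D.ε
  rotation-^-multiple (divides q refl) i = begin
    (false , i) ^ᴳ (q * n)       ≡⟨ cong (_^ᴳ (q * n)) (rot-toℕ i) ⟨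
    rot (toℕ i) ^ᴳ (q * n)       ≡⟨ rot-^ (toℕ i) (q * n) ⟩
    rot (q * n * toℕ i)          ≡⟨ cong rot (+-*-Solver.solve 3 (λ q n i → q :* n :* i := i :* q :* n) refl q n (toℕ i)) ⟩
    rot (toℕ i * q * n)          ≡⟨ rot-* (toℕ i * q) ⟩
    D.ε                          ∎

  exponent : ∀ {k} → 2 ∣ k → n ∣ k → ∀ d → d ^ᴳ k ≡ D.ε
  exponent 2∣k _ (true , i) = reflection-^-even 2∣k i
  exponent _ n∣k (false , i) = rotation-^-multiple n∣k i

Z₂-^-even : ∀ b k → 2 ∣ k → _^_ Z₂ b k ≡ false
Z₂-^-even b _ (divides q refl) = trans (^-* b q 2) (trans (cong (_^ᴳ q) (b²≡ε b)) (ε^ q))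
  where
  open FinGroupProperties Z₂
  b²≡ε : ∀ b → b ^ᴳ 2 ≡ false
  b²≡ε false = refl
  b²≡ε true = refl

Z₂-true-^-odd : ∀ k → ¬ 2 ∣ k → _^_ Z₂ true k ≡ true
Z₂-true-^-odd zero odd = ⊥-elim (odd (divides 0 refl))
Z₂-true-^-odd (suc zero) _ = refl
Z₂-true-^-odd (suc (suc k)) odd = trans (not-involutive _) (Z₂-true-^-odd k (λ { (divides q refl) → odd (divides (suc q) refl) }))

module G₁Properties (n : ℕ) .{{_ : NonZero n}} where
  private
    module D = FinGroup (Dihedral.D₂ₙ n)
  open FinGroup (G₁ n) using (_∙_)
  open FinGroupProperties (G₁ n)

  order-G₁ : order (G₁ n) ≡ 4 * n
  order-G₁ = trans (length-cartesianProduct (true ∷ false ∷ []) D.elements)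
                   (trans (cong (2 *_) (DihedralProperties.order-D₂ₙ n)) (sym (*-assoc 2 2 n)))

  ^-pair : ∀ x k → x ^ᴳ k ≡ (_^_ Z₂ (proj₁ x) k , _^_ (Dihedral.D₂ₙ n) (proj₂ x) k)
  ^-pair x zero = refl
  ^-pair x (suc k) = cong (x ∙_) (^-pair x k)

  exponent-G₁ : 2 ∣ n → ∀ x → x ^ᴳ n ≡ FinGroup.ε (G₁ n)
  exponent-G₁ 2∣n x = trans (^-pair x n)
    (cong₂ _,_ (Z₂-^-even _ n 2∣n) (DihedralProperties.exponent n 2∣n (divides 1 (sym (*-identityˡ n))) (proj₂ x)))

G₂≇G₁ : ∀ {m n} .{{_ : NonZero m}} .{{_ : NonZero n}} → 2 ∣ n → n < m → ¬ (G₂ m ≅ G₁ n)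
G₂≇G₁ {m} {n} 2∣n n<m G₂≅G₁ =
  rot-≢ε (>-nonZero⁻¹ n) n<m (trans (sym (ρ^ n)) (≅-exponent G₂≅G₁ n (exponent-G₁ 2∣n) (rot 1)))
  where
  open Dihedral m using (rot)
  open DihedralProperties m using (rot-≢ε; ρ^)
  open G₁Properties n using (exponent-G₁)

module DihedralHom (G : FinGroup) (n : ℕ) .{{_ : NonZero n}} (s ρ : Carrier G)
                   (s²≡ε : FinGroup._∙_ G s s ≡ FinGroup.ε G) (ρⁿ≡ε : _^_ G ρ n ≡ FinGroup.ε G)
                   (sρ⁻¹≡ρs : FinGroup._∙_ G s (FinGroup._⁻¹ G ρ) ≡ FinGroup._∙_ G ρ s) where
  open FinGroup G hiding (Carrier; ε; order)
  open FinGroup G using () renaming (Carrier to C)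
  open FinGroupProperties G
  open Dihedral n
  open DihedralProperties n using (toℕ-fromℕn)
  private
    module D = FinGroup D₂ₙ
  open ≡-Reasoning

  ψ : Carrier D₂ₙ → C
  ψ (a , i) = s ^ᵇ a ∙ ρ ^ᴳ toℕ i

  ρ^-fromℕn : ∀ k → ρ ^ᴳ toℕ (fromℕn k) ≡ ρ ^ᴳ k
  ρ^-fromℕn k = trans (cong (ρ ^ᴳ_) (toℕ-fromℕn k)) (^-% ρⁿ≡ε k)

  private
    ψ-∙ : ∀ a b (u i j : Fin n) → s ^ᵇ b ∙ ρ ^ᴳ toℕ u ≡ ρ ^ᴳ toℕ i ∙ s ^ᵇ b →
          s ^ᵇ (a xor b) ∙ ρ ^ᴳ toℕ (u +z j) ≡ (s ^ᵇ a ∙ ρ ^ᴳ toℕ i) ∙ (s ^ᵇ b ∙ ρ ^ᴳ toℕ j)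
    ψ-∙ a b u i j sᵇρᵘ≡ρⁱsᵇ = begin
      s ^ᵇ (a xor b) ∙ ρ ^ᴳ toℕ (u +z j)                ≡⟨ cong (s ^ᵇ (a xor b) ∙_) (ρ^-fromℕn _) ⟩
      s ^ᵇ (a xor b) ∙ ρ ^ᴳ (toℕ u + toℕ j)             ≡⟨ cong₂ _∙_ (sym (^ᵇ-xor s²≡ε a b)) (^-+ ρ (toℕ u) (toℕ j)) ⟩
      (s ^ᵇ a ∙ s ^ᵇ b) ∙ (ρ ^ᴳ toℕ u ∙ ρ ^ᴳ toℕ j)     ≡⟨ solve monoid ⟩
      s ^ᵇ a ∙ (s ^ᵇ b ∙ ρ ^ᴳ toℕ u) ∙ ρ ^ᴳ toℕ j       ≡⟨ cong (λ v → s ^ᵇ a ∙ v ∙ ρ ^ᴳ toℕ j) sᵇρᵘ≡ρⁱsᵇ ⟩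
      s ^ᵇ a ∙ (ρ ^ᴳ toℕ i ∙ s ^ᵇ b) ∙ ρ ^ᴳ toℕ j       ≡⟨ solve monoid ⟩
      (s ^ᵇ a ∙ ρ ^ᴳ toℕ i) ∙ (s ^ᵇ b ∙ ρ ^ᴳ toℕ j)     ∎

    s∙ρ⁻ⁱ : ∀ i → s ∙ ρ ^ᴳ toℕ (-z i) ≡ ρ ^ᴳ toℕ i ∙ s
    s∙ρ⁻ⁱ i = begin
      s ∙ ρ ^ᴳ toℕ (-z i)       ≡⟨ cong (s ∙_) (ρ^-fromℕn (n ∸ toℕ i)) ⟩
      s ∙ ρ ^ᴳ (n ∸ toℕ i)      ≡⟨ cong (s ∙_) (⁻¹-^ ρⁿ≡ε (<⇒≤ (toℕ<n i))) ⟨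
      s ∙ (ρ ⁻¹) ^ᴳ toℕ i       ≡⟨ ^-conj sρ⁻¹≡ρs (toℕ i) ⟩
      ρ ^ᴳ toℕ i ∙ s            ∎

  ψ-hom : ∀ x y → ψ (x D.∙ y) ≡ ψ x ∙ ψ y
  ψ-hom (a , i) (false , j) = ψ-∙ a false i i j (sym (commute-ε _))
  ψ-hom (a , i) (true , j) = ψ-∙ a true (-z i) i j (s∙ρ⁻ⁱ i)

  ψ-rot : ∀ k → ψ (rot k) ≡ ρ ^ᴳ k
  ψ-rot k = trans (identityˡ _) (ρ^-fromℕn k)

  ψ-refl-rot : ∀ k → ψ (refl-rot k) ≡ s ∙ ρ ^ᴳ k
  ψ-refl-rot k = cong (s ∙_) (ρ^-fromℕn k)

  ψ-s : ψ (refl-rot 0) ≡ s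
  ψ-s = trans (ψ-refl-rot 0) (identityʳ s)

-- Regular linear hypermaps
module RegularLinearHypermapProperties {G : FinGroup} {r₀ r₁ r₂ : Carrier G}
                                       (M : RegularLinearHypermap G r₀ r₁ r₂) where
  open FinGroup G hiding (Carrier; ε; order)
  open FinGroup G using () renaming (Carrier to C; ε to e)
  open FinGroupProperties G
  open RegularLinearHypermap M
  open ≡-Reasoning

  H K Z : Pred C 0ℓ
  H = ⟨ G ⟩ (r₁ ∷ r₂ ∷ [])
  K = ⟨ G ⟩ (r₀ ∷ r₂ ∷ [])
  Z = ⟨ G ⟩ (r₂ ∷ [])

  t : C
  t = r₀ ∙ r₁

  r₀²≡ε : r₀ ∙ r₀ ≡ e
  r₀²≡ε = proj₂ inv₀

  r₁²≡ε : r₁ ∙ r₁ ≡ e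
  r₁²≡ε = proj₂ inv₁

  r₂²≡ε : r₂ ∙ r₂ ≡ e
  r₂²≡ε = proj₂ inv₂

  Z-elements : ∀ {x} → Z x → x ≡ e ⊎ x ≡ r₂
  Z-elements = span-involution r₂²≡ε

  H∩K⊆Z : ∀ {x} → H x → K x → Z x
  H∩K⊆Z h k = proj₁ linear₁ (h , k)

  HK∩KH⊆H∪K : ∀ {x a b c d} → H a → K b → K c → H d → x ≡ a ∙ b → x ≡ c ∙ d → H x ⊎ K x
  HK∩KH⊆H∪K {a = a} {b} {c} {d} ha kb kc hd x≡ab x≡cd = proj₁ linear₂ ((a , b , ha , kb , x≡ab) , (c , d , kc , hd , x≡cd))

  ∉Z : ∀ {x} → ¬ x ≡ e → ¬ x ≡ r₂ → ¬ Z x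
  ∉Z x≢ε x≢r₂ z with Z-elements z
  ... | inj₁ x≡ε = x≢ε x≡ε
  ... | inj₂ x≡r₂ = x≢r₂ x≡r₂

  r₀∉H : ¬ H r₀
  r₀∉H h = ∉Z (proj₁ inv₀) r₀≢r₂ (H∩K⊆Z h gen₀)

  r₁∉K : ¬ K r₁
  r₁∉K k = ∉Z (proj₁ inv₁) r₁≢r₂ (H∩K⊆Z gen₀ k)

  -- t = r₀ r₁ lies in KH, so if it lay in HK it would lie in H ∪ K.
  t∉HK : ∀ {a b} → H a → K b → ¬ t ≡ a ∙ b
  t∉HK ha kb t≡ab with HK∩KH⊆H∪K ha kb gen₀ gen₀ t≡ab refl
  ... | inj₁ ht = r₀∉H (subst H (involution-cancelʳ r₁²≡ε r₀) (mul ht gen₀))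
  ... | inj₂ kt = r₁∉K (subst K (involution-cancelˡ r₀²≡ε r₁) (mul gen₀ kt))

  t⁻¹≡r₁r₀ : t ⁻¹ ≡ r₁ ∙ r₀
  t⁻¹≡r₁r₀ = involutions-∙-⁻¹ r₀²≡ε r₁²≡ε

  t≢ε : ¬ t ≡ e
  t≢ε = ≢-involution⇒∙≢ε r₁²≡ε r₀≢r₁

  t²≢ε : ¬ t ∙ t ≡ e
  t²≢ε t²≡ε = t∉HK gen₀ gen₀ (trans (inverseˡ-unique t t t²≡ε) t⁻¹≡r₁r₀)

  normal⊆H⇒⊆Z : ∀ N → IsNormalSubgroup G N → N ⊆ H → N ⊆ Z
  normal⊆H⇒⊆Z N (_ , _ , _ , conjugate) N⊆H {x} nx
    with HK∩KH⊆H∪K (N⊆H nx) gen₀ gen₀ (N⊆H (conjugate r₀ nx)) refl (sym (a∙a⁻¹xa≡xa r₀ x))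
  ... | inj₁ hxr₀ = ⊥-elim (r₀∉H (subst H (\\-leftDividesʳ x r₀) (mul (inv (N⊆H nx)) hxr₀)))
  ... | inj₂ kxr₀ = H∩K⊆Z (N⊆H nx) (subst K (//-rightDividesʳ r₀ x) (mul kxr₀ (inv gen₀)))

  conjugate∈Z⇒commute : ∀ {a} → Z (a ⁻¹ ∙ r₂ ∙ a) → Commute a r₂
  conjugate∈Z⇒commute {a} z with Z-elements z
  ... | inj₁ conj≡ε = ⊥-elim (proj₁ inv₂ (∙-cancelʳ a r₂ e (begin
    r₂ ∙ a                ≡⟨ a∙a⁻¹xa≡xa a r₂ ⟨
    a ∙ (a ⁻¹ ∙ r₂ ∙ a)   ≡⟨ cong (a ∙_) conj≡ε ⟩
    a ∙ e                 ≡⟨ commute-ε a ⟩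
    e ∙ a                 ∎)))
  ... | inj₂ conj≡r₂ = trans (cong (a ∙_) (sym conj≡r₂)) (a∙a⁻¹xa≡xa a r₂)

  r₂-central : Commute r₀ r₂ → Commute r₁ r₂ → ∀ g → Commute r₂ g
  r₂-central r₀r₂≡r₂r₀ r₁r₂≡r₂r₁ = central-if-commutes-with-generators generators generates
    where
    generators : (_∈ r₀ ∷ r₁ ∷ r₂ ∷ []) ⊆ Commute r₂
    generators (here refl) = sym r₀r₂≡r₂r₀
    generators (there (here refl)) = sym r₁r₂≡r₂r₁
    generators (there (there (here refl))) = refl

  core≡Z : (∀ g → Commute r₂ g) → IsCore G H Z
  core≡Z central = (unit , mul , inv , conjugate) , span-mono Z⊆H , normal⊆H⇒⊆Z
    where
    Z⊆H : (_∈ r₂ ∷ []) ⊆ H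
    Z⊆H (here refl) = gen₁
    conjugate : ∀ g {x} → Z x → Z (g ⁻¹ ∙ x ∙ g)
    conjugate g {x} z = subst Z (sym (∙-cancelˡ g _ _ (trans (a∙a⁻¹xa≡xa g x) (sym x-central)))) z
      where
      x-central : Commute g x
      x-central with Z-elements z
      ... | inj₁ refl = commute-ε g
      ... | inj₂ refl = sym (central g)

  core≡1 : ¬ (Commute r₀ r₂ × Commute r₁ r₂) → IsCore G H (𝟏 G)
  core≡1 not-central = (refl , closed-∙ , closed-⁻¹ , conjugate) , (λ { refl → unit }) , maximal
    where
    closed-∙ : ∀ {x y} → e ≡ x → e ≡ y → e ≡ x ∙ y
    closed-∙ refl refl = sym (identityˡ e)
    closed-⁻¹ : ∀ {x} → e ≡ x → e ≡ x ⁻¹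
    closed-⁻¹ refl = sym ε⁻¹≈ε
    conjugate : ∀ g {x} → e ≡ x → e ≡ g ⁻¹ ∙ x ∙ g
    conjugate g refl = ∙-cancelˡ g _ _ (trans (commute-ε g) (sym (a∙a⁻¹xa≡xa g e)))
    maximal : ∀ N → IsNormalSubgroup G N → N ⊆ H → N ⊆ 𝟏 G
    maximal N N⊴G@(_ , _ , _ , conjugateN) N⊆H nx with Z-elements (normal⊆H⇒⊆Z N N⊴G N⊆H nx)
    ... | inj₁ x≡ε = sym x≡ε
    ... | inj₂ refl = ⊥-elim (not-central (commutes (conjugateN r₀ nx) , commutes (conjugateN r₁ nx)))
      where
      commutes : ∀ {a} → N (a ⁻¹ ∙ r₂ ∙ a) → Commute a r₂
      commutes n = conjugate∈Z⇒commute (normal⊆H⇒⊆Z N N⊴G N⊆H n)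

  core≡Z⇒commute : IsCore G H Z → Commute r₀ r₂ × Commute r₁ r₂
  core≡Z⇒commute ((_ , _ , _ , conjugate) , _) = conjugate∈Z⇒commute (conjugate r₀ gen₀) , conjugate∈Z⇒commute (conjugate r₁ gen₀)

module CentralHypermap {G : FinGroup} {r₀ r₁ r₂ : Carrier G} (M : RegularLinearHypermap G r₀ r₁ r₂)
                       (r₀r₂≡r₂r₀ : FinGroupProperties.Commute G r₀ r₂) (r₁r₂≡r₂r₁ : FinGroupProperties.Commute G r₁ r₂)
                       {n : ℕ} (|r₀r₁|≡n : HasOrder G (FinGroup._∙_ G r₀ r₁) n) where
  open FinGroup G hiding (Carrier; ε; order)
  open FinGroup G using () renaming (Carrier to C; ε to e)
  open FinGroupProperties G
  open RegularLinearHypermap M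
  open RegularLinearHypermapProperties M
  open HasOrderProperties G |r₀r₁|≡n renaming (xⁿ≡ε to tⁿ≡ε)
  open Dihedral n using (rot; refl-rot; fromℕn; -z_; 0z; D₂ₙ)
  open DihedralProperties n using (toℕ-0z)
  open ≡-Reasoning

  central : ∀ g → Commute r₂ g
  central = r₂-central r₀r₂≡r₂r₀ r₁r₂≡r₂r₁

  3≤n : 3 ≤ n
  3≤n = at-least-3 n (proj₁ |r₀r₁|≡n) (λ { refl → t≢ε (trans (sym (identityʳ t)) tⁿ≡ε) })
                                        (λ { refl → t²≢ε (trans (sym (^-2 t)) tⁿ≡ε) })
    where
    at-least-3 : ∀ k → 0 < k → ¬ k ≡ 1 → ¬ k ≡ 2 → 3 ≤ k
    at-least-3 1 _ k≢1 _ = ⊥-elim (k≢1 refl)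
    at-least-3 2 _ _ k≢2 = ⊥-elim (k≢2 refl)
    at-least-3 (suc (suc (suc _))) _ _ _ = s≤s (s≤s (s≤s z≤n))

  r₀t⁻¹≡tr₀ : r₀ ∙ t ⁻¹ ≡ t ∙ r₀
  r₀t⁻¹≡tr₀ = trans (cong (r₀ ∙_) t⁻¹≡r₁r₀) (sym (assoc r₀ r₁ r₀))

  open DihedralHom G n r₀ t r₀²≡ε tⁿ≡ε r₀t⁻¹≡tr₀ public using (ψ; ψ-hom; ψ-rot; ψ-refl-rot; ψ-s; ρ^-fromℕn)

  ψ-r₁ : ψ (refl-rot 1) ≡ r₁
  ψ-r₁ = trans (ψ-refl-rot 1) (trans (cong (r₀ ∙_) (identityʳ t)) (involution-cancelˡ r₀²≡ε r₁))

  ¬Commute-t-r₀ : ¬ Commute t r₀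
  ¬Commute-t-r₀ tr₀≡r₀t = t²≢ε (trans (cong (t ∙_) (sym t⁻¹≡t)) (inverseʳ t))
    where
    t⁻¹≡t : t ⁻¹ ≡ t
    t⁻¹≡t = ∙-cancelˡ r₀ _ _ (trans r₀t⁻¹≡tr₀ tr₀≡r₀t)

  -- If z r₀ w = ε then r₀ = z⁻¹ w⁻¹ would commute with t.
  centralizer-r₀-centralizer-≢ε : ∀ {z w} → Commute t z → Commute t w → ¬ z ∙ (r₀ ∙ w) ≡ e
  centralizer-r₀-centralizer-≢ε {z} {w} tz≡zt tw≡wt zr₀w≡ε = ¬Commute-t-r₀ (subst (Commute t) (sym r₀≡z⁻¹w⁻¹)
    (commute-∙ (commute-⁻¹ tz≡zt) (commute-⁻¹ tw≡wt)))
    where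
    r₀≡z⁻¹w⁻¹ : r₀ ≡ z ⁻¹ ∙ w ⁻¹
    r₀≡z⁻¹w⁻¹ = ∙-cancelʳ w _ _ (trans (∙-cancelˡ z _ _ (trans zr₀w≡ε (sym (inverseʳ z))))
                  (sym (trans (assoc (z ⁻¹) (w ⁻¹) w) (trans (cong (z ⁻¹ ∙_) (inverseˡ w)) (identityʳ _)))))

  ψ-rotation-kernel : ∀ i → ψ (false , i) ≡ e → i ≡ 0z
  ψ-rotation-kernel i ψ≡ε = toℕ-injective (trans (^≡ε⇒≡0 (trans (sym (identityˡ _)) ψ≡ε) (toℕ<n i)) (sym toℕ-0z))

  ψ-reflection-≢ε : ∀ i → ¬ ψ (true , i) ≡ e
  ψ-reflection-≢ε i ψ≡ε = centralizer-r₀-centralizer-≢ε (commute-ε t) (commute-^ refl (toℕ i)) (trans (identityˡ _) ψ≡ε)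

  PowerOfT : C → Set
  PowerOfT x = ∃ λ j → x ≡ t ^ᴳ j

  r₂-power-of-t? : Dec (PowerOfT r₂)
  r₂-power-of-t? with any? (λ (i : Fin n) → r₂ ≟ (t ^ᴳ toℕ i))
  ... | yes (i , r₂≡tⁱ) = yes (toℕ i , r₂≡tⁱ)
  ... | no none = no (λ (j , r₂≡tʲ) → none (fromℕn j , trans r₂≡tʲ (sym (ρ^-fromℕn j))))

  module PowerOfTCase (j : ℕ) (r₂≡tʲ : r₂ ≡ t ^ᴳ j) where
    h : ℕ
    h = j % n

    r₂≡tʰ : r₂ ≡ t ^ᴳ h
    r₂≡tʰ = trans r₂≡tʲ (sym (^-% tⁿ≡ε j))

    h+h≡n : h + h ≡ n
    h+h≡n with ^≡ε⇒≡0∨≡n t²ʰ≡ε (+-mono-< (m%n<n j n) (m%n<n j n))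
      where
      t²ʰ≡ε : t ^ᴳ (h + h) ≡ e
      t²ʰ≡ε = trans (^-+ t h h) (trans (cong₂ _∙_ (sym r₂≡tʰ) (sym r₂≡tʰ)) r₂²≡ε)
    ... | inj₂ h+h≡n = h+h≡n
    ... | inj₁ h+h≡0 = ⊥-elim (proj₁ inv₂ (trans r₂≡tʰ (cong (t ^ᴳ_) (m+n≡0⇒m≡0 h h+h≡0))))

    n≡h*2 : n ≡ h * 2
    n≡h*2 = trans (sym h+h≡n) (trans (cong (h +_) (sym (+-identityʳ h))) (*-comm 2 h))

    2∣n : 2 ∣ n
    2∣n = divides h n≡h*2

    n/2≡h : n / 2 ≡ h
    n/2≡h = trans (cong (_/ 2) n≡h*2) (m*n/n≡m h 2)

    -- For n = 4 we would get r₂ = t², and then t = (r₁ r₂) r₀ ∈ HK.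
    h≢2 : ¬ h ≡ 2
    h≢2 h≡2 = t∉HK (mul gen₀ gen₁) gen₀ (sym (begin
      (r₁ ∙ r₂) ∙ r₀              ≡⟨ cong₂ (λ u v → (u ∙ v) ∙ r₀) (sym (involution-cancelˡ r₀²≡ε r₁)) (trans r₂≡tʰ (cong (t ^ᴳ_) h≡2)) ⟩
      ((r₀ ∙ t) ∙ t ^ᴳ 2) ∙ r₀    ≡⟨ solve monoid ⟩
      r₀ ∙ (t ^ᴳ 3 ∙ r₀)          ≡⟨ cong (r₀ ∙_) (^-conj r₀t⁻¹≡tr₀ 3) ⟨
      r₀ ∙ (r₀ ∙ (t ⁻¹) ^ᴳ 3)     ≡⟨ involution-cancelˡ r₀²≡ε _ ⟩
      (t ⁻¹) ^ᴳ 3                 ≡⟨ ⁻¹-^ tⁿ≡ε (subst (3 ≤_) (sym n≡4) (s≤s (s≤s (s≤s z≤n)))) ⟩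
      t ^ᴳ (n ∸ 3)                ≡⟨ cong (λ k → t ^ᴳ (k ∸ 3)) n≡4 ⟩
      t ^ᴳ 1                      ≡⟨ identityʳ t ⟩
      t                           ∎))
      where
      n≡4 : n ≡ 4
      n≡4 = trans (sym h+h≡n) (cong (λ k → k + k) h≡2)

    6≤n : 6 ≤ n
    6≤n = subst (6 ≤_) h+h≡n (+-mono-≤ 3≤h 3≤h)
      where
      half-≥3 : ∀ k → 3 ≤ k + k → ¬ k ≡ 2 → 3 ≤ k
      half-≥3 1 (s≤s (s≤s ())) _
      half-≥3 2 _ k≢2 = ⊥-elim (k≢2 refl)
      half-≥3 (suc (suc (suc _))) _ _ = s≤s (s≤s (s≤s z≤n))
      3≤h : 3 ≤ h
      3≤h = half-≥3 h (subst (3 ≤_) (sym h+h≡n) 3≤n) h≢2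

    ψ-kernel-trivial : ∀ x → ψ x ≡ e → x ≡ FinGroup.ε D₂ₙ
    ψ-kernel-trivial (true , i) ψ≡ε = ⊥-elim (ψ-reflection-≢ε i ψ≡ε)
    ψ-kernel-trivial (false , i) ψ≡ε = cong (false ,_) (ψ-rotation-kernel i ψ≡ε)

    open Homomorphism D₂ₙ G ψ ψ-hom using (Image; image-isSubgroup; module Bijective)

    ψ-r₂ : ψ (rot h) ≡ r₂
    ψ-r₂ = trans (ψ-rot h) (sym r₂≡tʰ)

    generators-in-image : (_∈ r₀ ∷ r₁ ∷ r₂ ∷ []) ⊆ Image
    generators-in-image (here refl) = refl-rot 0 , ψ-s
    generators-in-image (there (here refl)) = refl-rot 1 , ψ-r₁
    generators-in-image (there (there (here refl))) = rot h , ψ-r₂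

    open Bijective ψ-kernel-trivial (λ y → span-least image-isSubgroup generators-in-image (generates y))

    G≅G₂ : G ≅ G₂ n
    G≅G₂ = inverse-≅

    M≅M₃ : HypermapIso G r₀ r₁ r₂ (G₂ n) (r₀² n) (r₁² n) (r₂² n)
    M≅M₃ = inverse-hypermapIso ψ-s ψ-r₁ (trans (cong (λ k → ψ (rot k)) n/2≡h) ψ-r₂)

  module NonPowerOfTCase (r₂∉⟨t⟩ : ¬ PowerOfT r₂) where
    private
      module G₁ = FinGroup (G₁ n)

    φ : Carrier (G₁ n) → C
    φ (c , d) = r₂ ^ᵇ c ∙ ψ d

    φ-hom : ∀ x y → φ (x G₁.∙ y) ≡ φ x ∙ φ y
    φ-hom (c , d) (c′ , d′) = begin
      r₂ ^ᵇ (c xor c′) ∙ ψ (d D.∙ d′)          ≡⟨ cong₂ _∙_ (sym (^ᵇ-xor r₂²≡ε c c′)) (ψ-hom d d′) ⟩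
      (r₂ ^ᵇ c ∙ r₂ ^ᵇ c′) ∙ (ψ d ∙ ψ d′)      ≡⟨ middle-swap (sym (commute-^ᵇ (sym (central (ψ d))) c′)) ⟩
      (r₂ ^ᵇ c ∙ ψ d) ∙ (r₂ ^ᵇ c′ ∙ ψ d′)      ∎
      where
      module D = FinGroup D₂ₙ

    φ-kernel-trivial : ∀ x → φ x ≡ e → x ≡ G₁.ε
    φ-kernel-trivial (c , (true , i)) φ≡ε =
      ⊥-elim (centralizer-r₀-centralizer-≢ε (commute-^ᵇ (sym (central t)) c) (commute-^ refl (toℕ i)) φ≡ε)
    φ-kernel-trivial (true , (false , i)) φ≡ε = ⊥-elim (r₂∉⟨t⟩ (n ∸ toℕ i , (begin
      r₂                        ≡⟨ inverseˡ-unique r₂ _ φ≡ε ⟩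
      (e ∙ t ^ᴳ toℕ i) ⁻¹       ≡⟨ cong _⁻¹ (identityˡ _) ⟩
      (t ^ᴳ toℕ i) ⁻¹           ≡⟨ ^-⁻¹ t (toℕ i) ⟨
      (t ⁻¹) ^ᴳ toℕ i           ≡⟨ ⁻¹-^ tⁿ≡ε (<⇒≤ (toℕ<n i)) ⟩
      t ^ᴳ (n ∸ toℕ i)          ∎)))
    φ-kernel-trivial (false , (false , i)) φ≡ε =
      cong (λ u → false , false , u) (ψ-rotation-kernel i (trans (sym (identityˡ _)) φ≡ε))

    open Homomorphism (G₁ n) G φ φ-hom using (Image; image-isSubgroup; module Bijective)

    φ-s₀ : φ (r₀¹ n) ≡ r₀
    φ-s₀ = trans (identityˡ _) ψ-s

    φ-s₁ : φ (r₁¹ n) ≡ r₁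
    φ-s₁ = trans (identityˡ _) ψ-r₁

    φ-s₂ : φ (r₂¹ n) ≡ r₂
    φ-s₂ = trans (cong (r₂ ∙_) (ψ-rot 0)) (identityʳ r₂)

    generators-in-image : (_∈ r₀ ∷ r₁ ∷ r₂ ∷ []) ⊆ Image
    generators-in-image (here refl) = r₀¹ n , φ-s₀
    generators-in-image (there (here refl)) = r₁¹ n , φ-s₁
    generators-in-image (there (there (here refl))) = r₂¹ n , φ-s₂

    open Bijective φ-kernel-trivial (λ y → span-least image-isSubgroup generators-in-image (generates y))

    G≅G₁ : G ≅ G₁ n
    G≅G₁ = inverse-≅

    M≅M₁ : HypermapIso G r₀ r₁ r₂ (G₁ n) (r₀¹ n) (r₁¹ n) (r₂¹ n)
    M≅M₁ = inverse-hypermapIso φ-s₀ φ-s₁ φ-s₂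

data CentralClassification (G : FinGroup) (r₀ r₁ r₂ : Carrier G) : Set where
  type-G₁ : ∀ n {{_ : NonZero n}} → 3 ≤ n → G ≅ G₁ n →
            HypermapIso G r₀ r₁ r₂ (G₁ n) (r₀¹ n) (r₁¹ n) (r₂¹ n) → CentralClassification G r₀ r₁ r₂
  type-G₂ : ∀ m {{_ : NonZero m}} → 2 ∣ m → 6 ≤ m → G ≅ G₂ m →
            HypermapIso G r₀ r₁ r₂ (G₂ m) (r₀² m) (r₁² m) (r₂² m) → CentralClassification G r₀ r₁ r₂

classify-central : ∀ {G r₀ r₁ r₂} → RegularLinearHypermap G r₀ r₁ r₂ →
                   FinGroupProperties.Commute G r₀ r₂ → FinGroupProperties.Commute G r₁ r₂ →
                   CentralClassification G r₀ r₁ r₂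
classify-central {G} {r₀} {r₁} M r₀r₂≡r₂r₀ r₁r₂≡r₂r₁ with ElementOrder.order-exists G (FinGroup._∙_ G r₀ r₁)
... | n , |t|≡n with r₂-power-of-t?
  where open CentralHypermap M r₀r₂≡r₂r₀ r₁r₂≡r₂r₁ |t|≡n
...   | yes (j , r₂≡tʲ) = type-G₂ n {{n-nonZero}} 2∣n 6≤n G≅G₂ M≅M₃
  where
  open HasOrderProperties G |t|≡n using (n-nonZero)
  open CentralHypermap.PowerOfTCase M r₀r₂≡r₂r₀ r₁r₂≡r₂r₁ |t|≡n j r₂≡tʲ
...   | no r₂∉⟨t⟩ = type-G₁ n {{n-nonZero}} 3≤n G≅G₁ M≅M₁
  where
  open HasOrderProperties G |t|≡n using (n-nonZero)
  open CentralHypermap M r₀r₂≡r₂r₀ r₁r₂≡r₂r₁ |t|≡n using (3≤n)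
  open CentralHypermap.NonPowerOfTCase M r₀r₂≡r₂r₀ r₁r₂≡r₂r₁ |t|≡n r₂∉⟨t⟩

module _ {G : FinGroup} where
  ≅G₁-unique : ∀ {n n′} .{{_ : NonZero n}} .{{_ : NonZero n′}} → G ≅ G₁ n → G ≅ G₁ n′ → n ≡ n′
  ≅G₁-unique {n} {n′} G≅G₁n G≅G₁n′ = *-cancelˡ-≡ n n′ 4 (begin
    4 * n          ≡⟨ G₁Properties.order-G₁ n ⟨
    order (G₁ n)   ≡⟨ ≅-order G≅G₁n ⟨
    order G        ≡⟨ ≅-order G≅G₁n′ ⟩
    order (G₁ n′)  ≡⟨ G₁Properties.order-G₁ n′ ⟩
    4 * n′         ∎)
    where open ≡-Reasoning

  ≅G₂-unique : ∀ {m m′} .{{_ : NonZero m}} .{{_ : NonZero m′}} → G ≅ G₂ m → G ≅ G₂ m′ → m ≡ m′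
  ≅G₂-unique {m} {m′} G≅G₂m G≅G₂m′ = *-cancelˡ-≡ m m′ 2 (begin
    2 * m          ≡⟨ DihedralProperties.order-D₂ₙ m ⟨
    order (G₂ m)   ≡⟨ ≅-order G≅G₂m ⟨
    order G        ≡⟨ ≅-order G≅G₂m′ ⟩
    order (G₂ m′)  ≡⟨ DihedralProperties.order-D₂ₙ m′ ⟩
    2 * m′         ∎)
    where open ≡-Reasoning

  ≅G₂-≅G₁-order : ∀ {m n} .{{_ : NonZero m}} .{{_ : NonZero n}} → G ≅ G₂ m → G ≅ G₁ n → m ≡ 2 * n
  ≅G₂-≅G₁-order {m} {n} G≅G₂ G≅G₁ = *-cancelˡ-≡ m (2 * n) 2 (begin
    2 * m          ≡⟨ DihedralProperties.order-D₂ₙ m ⟨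
    order (G₂ m)   ≡⟨ ≅-order G≅G₂ ⟨
    order G        ≡⟨ ≅-order G≅G₁ ⟩
    order (G₁ n)   ≡⟨ G₁Properties.order-G₁ n ⟩
    4 * n          ≡⟨ *-assoc 2 2 n ⟩
    2 * (2 * n)    ∎)
    where open ≡-Reasoning

module CommutingInvolutionHypermap {G : FinGroup} {r₀ r₁ r₂ : Carrier G}
         (inv₀ : Involution G r₀) (inv₁ : Involution G r₁) (inv₂ : Involution G r₂)
         (r₀≢r₁ : ¬ r₀ ≡ r₁) (r₀≢r₂ : ¬ r₀ ≡ r₂) (r₁≢r₂ : ¬ r₁ ≡ r₂)
         (r₀r₂≡r₂r₀ : FinGroupProperties.Commute G r₀ r₂) (r₁r₂≡r₂r₁ : FinGroupProperties.Commute G r₁ r₂)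
         (generates : ∀ x → ⟨ G ⟩ (r₀ ∷ r₁ ∷ r₂ ∷ []) x)
         (t≢r₂ : ¬ FinGroup._∙_ G r₀ r₁ ≡ r₂)
         (t²≢ε : ¬ FinGroup._∙_ G (FinGroup._∙_ G r₀ r₁) (FinGroup._∙_ G r₀ r₁) ≡ FinGroup.ε G)
         (t²≢r₂ : ¬ FinGroup._∙_ G (FinGroup._∙_ G r₀ r₁) (FinGroup._∙_ G r₀ r₁) ≡ r₂) where
  open FinGroup G hiding (Carrier; ε; order)
  open FinGroup G using () renaming (Carrier to C; ε to e)
  open FinGroupProperties G
  open ≡-Reasoning

  private
    r₀²≡ε = proj₂ inv₀
    r₁²≡ε = proj₂ inv₁
    r₂²≡ε = proj₂ inv₂
    module H = CommutingInvolutions r₁²≡ε r₂²≡ε r₁r₂≡r₂r₁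
    module K = CommutingInvolutions r₀²≡ε r₂²≡ε r₀r₂≡r₂r₀

  H K : Pred C 0ℓ
  H = ⟨ G ⟩ (r₁ ∷ r₂ ∷ [])
  K = ⟨ G ⟩ (r₀ ∷ r₂ ∷ [])

  t : C
  t = r₀ ∙ r₁

  central : ∀ g → Commute r₂ g
  central = central-if-commutes-with-generators generators generates
    where
    generators : (_∈ r₀ ∷ r₁ ∷ r₂ ∷ []) ⊆ Commute r₂
    generators (here refl) = sym r₀r₂≡r₂r₀
    generators (there (here refl)) = sym r₁r₂≡r₂r₁
    generators (there (there (here refl))) = refl

  r₂ᵇ-central : ∀ c g → Commute (r₂ ^ᵇ c) g
  r₂ᵇ-central c g = sym (commute-^ᵇ (sym (central g)) c)

  r₂ᵇ∈H : ∀ c → H (r₂ ^ᵇ c)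
  r₂ᵇ∈H c = span-^ᵇ gen₁ c

  r₂ᵇ∈K : ∀ c → K (r₂ ^ᵇ c)
  r₂ᵇ∈K c = span-^ᵇ gen₁ c

  gather : ∀ c c′ x y → (r₂ ^ᵇ c ∙ x) ∙ (r₂ ^ᵇ c′ ∙ y) ≡ r₂ ^ᵇ (c xor c′) ∙ (x ∙ y)
  gather c c′ x y = trans (middle-swap (sym (r₂ᵇ-central c′ x))) (cong (_∙ (x ∙ y)) (^ᵇ-xor r₂²≡ε c c′))

  shift : ∀ c c′ {x y} → r₂ ^ᵇ c ∙ x ≡ r₂ ^ᵇ c′ ∙ y → x ≡ r₂ ^ᵇ (c xor c′) ∙ y
  shift c c′ {x} {y} eq = begin
    x                               ≡⟨ \\-leftDividesʳ (r₂ ^ᵇ c) x ⟨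
    (r₂ ^ᵇ c) ⁻¹ ∙ (r₂ ^ᵇ c ∙ x)    ≡⟨ cong₂ _∙_ (^ᵇ-⁻¹ r₂²≡ε c) eq ⟩
    r₂ ^ᵇ c ∙ (r₂ ^ᵇ c′ ∙ y)        ≡⟨ sym (assoc _ _ y) ⟩
    (r₂ ^ᵇ c ∙ r₂ ^ᵇ c′) ∙ y        ≡⟨ cong (_∙ y) (^ᵇ-xor r₂²≡ε c c′) ⟩
    r₂ ^ᵇ (c xor c′) ∙ y            ∎

  ∉r₂ᵇ : ∀ {x} → ¬ x ≡ e → ¬ x ≡ r₂ → ∀ d → ¬ x ≡ r₂ ^ᵇ d
  ∉r₂ᵇ x≢ε _ false = x≢ε
  ∉r₂ᵇ _ x≢r₂ true = x≢r₂

  t≢ε : ¬ t ≡ e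
  t≢ε = ≢-involution⇒∙≢ε r₁²≡ε r₀≢r₁

  H∩K⊆Z : ∀ {z} → H z × K z → ⟨ G ⟩ (r₂ ∷ []) z
  H∩K⊆Z (h , k) with H.span-normalForm h | K.span-normalForm k
  ... | c , false , refl | _ = mul (span-^ᵇ gen₀ c) unit
  ... | c , true , refl | c′ , false , eq =
    ⊥-elim (∉r₂ᵇ (proj₁ inv₁) r₁≢r₂ (c xor c′) (trans (shift c c′ eq) (identityʳ _)))
  ... | c , true , refl | c′ , true , eq = ⊥-elim (∉r₂ᵇ t≢ε t≢r₂ (c xor c′) (begin
    r₀ ∙ r₁                          ≡⟨ cong (r₀ ∙_) (shift c c′ eq) ⟩
    r₀ ∙ (r₂ ^ᵇ (c xor c′) ∙ r₀)     ≡⟨ cong (r₀ ∙_) (r₂ᵇ-central (c xor c′) r₀) ⟩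
    r₀ ∙ (r₀ ∙ r₂ ^ᵇ (c xor c′))     ≡⟨ involution-cancelˡ r₀²≡ε _ ⟩
    r₂ ^ᵇ (c xor c′)                 ∎))

  Z⊆H∩K : ∀ {z} → ⟨ G ⟩ (r₂ ∷ []) z → H z × K z
  Z⊆H∩K z = span-mono (λ { (here refl) → gen₁ }) z , span-mono (λ { (here refl) → gen₁ }) z

  -- When all four factors carry r₁ resp. r₀, equating the two products forces t² ∈ ⟨r₂⟩.
  HK∩KH⊆H∪K : ∀ {z} → _·_ G H K z × _·_ G K H z → H z ⊎ K z
  HK∩KH⊆H∪K ((h , k , hh , kk , z≡hk) , (k′ , h′ , kk′ , hh′ , z≡k′h′))
    with H.span-normalForm hh | K.span-normalForm kk | K.span-normalForm kk′ | H.span-normalForm hh′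
  ... | c , false , refl | _ | _ | _ = inj₂ (subst K (sym z≡hk) (mul (mul (r₂ᵇ∈K c) unit) kk))
  ... | _ | c , false , refl | _ | _ = inj₁ (subst H (sym z≡hk) (mul hh (mul (r₂ᵇ∈H c) unit)))
  ... | _ | _ | c , false , refl | _ = inj₁ (subst H (sym z≡k′h′) (mul (mul (r₂ᵇ∈H c) unit) hh′))
  ... | _ | _ | _ | c , false , refl = inj₂ (subst K (sym z≡k′h′) (mul kk′ (mul (r₂ᵇ∈K c) unit)))
  ... | c₁ , true , refl | c₂ , true , refl | c₃ , true , refl | c₄ , true , refl =
    ⊥-elim (∉r₂ᵇ t²≢ε t²≢r₂ d t²≡r₂ᵈ)
    where
    d : Bool
    d = (c₁ xor c₂) xor (c₃ xor c₄)
    t⁻¹≡r₂ᵈt : t ⁻¹ ≡ r₂ ^ᵇ d ∙ t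
    t⁻¹≡r₂ᵈt = trans (involutions-∙-⁻¹ r₀²≡ε r₁²≡ε) (shift (c₁ xor c₂) (c₃ xor c₄) (begin
      r₂ ^ᵇ (c₁ xor c₂) ∙ (r₁ ∙ r₀)            ≡⟨ gather c₁ c₂ r₁ r₀ ⟨
      (r₂ ^ᵇ c₁ ∙ r₁) ∙ (r₂ ^ᵇ c₂ ∙ r₀)        ≡⟨ trans (sym z≡hk) z≡k′h′ ⟩
      (r₂ ^ᵇ c₃ ∙ r₀) ∙ (r₂ ^ᵇ c₄ ∙ r₁)        ≡⟨ gather c₃ c₄ r₀ r₁ ⟩
      r₂ ^ᵇ (c₃ xor c₄) ∙ t                    ∎))
    t²≡r₂ᵈ : t ∙ t ≡ r₂ ^ᵇ d
    t²≡r₂ᵈ = trans (inverseʳ-unique (r₂ ^ᵇ d) (t ∙ t) (begin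
      r₂ ^ᵇ d ∙ (t ∙ t)     ≡⟨ sym (assoc _ t t) ⟩
      (r₂ ^ᵇ d ∙ t) ∙ t     ≡⟨ cong (_∙ t) (sym t⁻¹≡r₂ᵈt) ⟩
      t ⁻¹ ∙ t              ≡⟨ inverseˡ t ⟩
      e                     ∎)) (^ᵇ-⁻¹ r₂²≡ε d)

  H∪K⊆HK∩KH : ∀ {z} → H z ⊎ K z → _·_ G H K z × _·_ G K H z
  H∪K⊆HK∩KH {z} (inj₁ h) = (z , e , h , unit , sym (identityʳ z)) , (e , z , unit , h , sym (identityˡ z))
  H∪K⊆HK∩KH {z} (inj₂ k) = (e , z , unit , k , sym (identityˡ z)) , (z , e , k , unit , sym (identityʳ z))

  regularLinearHypermap : RegularLinearHypermap G r₀ r₁ r₂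
  regularLinearHypermap = record
    { inv₀ = inv₀ ; inv₁ = inv₁ ; inv₂ = inv₂ ; r₀≢r₁ = r₀≢r₁ ; r₀≢r₂ = r₀≢r₂ ; r₁≢r₂ = r₁≢r₂
    ; generates = generates ; linear₁ = H∩K⊆Z , Z⊆H∩K ; linear₂ = HK∩KH⊆H∪K , H∪K⊆HK∩KH }

  |H|≡4 : HasSize G H 4
  |H|≡4 = H.klein-four (proj₁ inv₁) (proj₁ inv₂) r₁≢r₂

  |K|≡4 : HasSize G K 4
  |K|≡4 = K.klein-four (proj₁ inv₀) (proj₁ inv₂) r₀≢r₂

  |r₁r₂|≡2 : HasOrder G (r₁ ∙ r₂) 2
  |r₁r₂|≡2 = involution-order (≢-involution⇒∙≢ε r₂²≡ε r₁≢r₂) H.product-involution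

  |r₀r₂|≡2 : HasOrder G (r₀ ∙ r₂) 2
  |r₀r₂|≡2 = involution-order (≢-involution⇒∙≢ε r₂²≡ε r₀≢r₂) K.product-involution

-- The hypermaps 𝓜₁, 𝓜₂ and 𝓜₃
module G₁Hypermaps (n : ℕ) .{{_ : NonZero n}} (3≤n : 3 ≤ n) where
  open FinGroup (G₁ n) hiding (Carrier; ε; order)
  open FinGroup (G₁ n) using () renaming (ε to e)
  open FinGroupProperties (G₁ n)
  open Dihedral n using (rot; refl-rot; D₂ₙ)
  open DihedralProperties n using (rot-+; rot-≢; rot-≢ε; rot-n; rot-+n; rot-*; ρ^; s∙sρ≡ρ; reflection-involution;
                                   generated-by-s-ρ; order-D₂ₙ)
  open G₁Properties n
  private
    module D = FinGroup D₂ₙ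
    module DP = FinGroupProperties D₂ₙ
  open ≡-Reasoning

  s₀ s₁ s₂ : Carrier (G₁ n)
  s₀ = r₀¹ n
  s₁ = r₁¹ n
  s₂ = r₂¹ n

  private
    0<n : 0 < n
    0<n = ≤-trans (s≤s z≤n) 3≤n

    1<n : 1 < n
    1<n = ≤-trans (s≤s (s≤s z≤n)) 3≤n

  inv₀ : Involution (G₁ n) s₀
  inv₀ = (λ ()) , cong (false ,_) (reflection-involution _)

  inv₁ : Involution (G₁ n) s₁
  inv₁ = (λ ()) , cong (false ,_) (reflection-involution _)

  inv₂ : Involution (G₁ n) s₂
  inv₂ = (λ ()) , cong (false ,_) (DP.identityˡ D.ε)

  s₀≢s₁ : ¬ s₀ ≡ s₁
  s₀≢s₁ eq = rot-≢ 0<n 1<n (λ ()) (cong (λ x → false , proj₂ (proj₂ x)) eq)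

  s₀s₂≡s₂s₀ : Commute s₀ s₂
  s₀s₂≡s₂s₀ = cong (true ,_) (trans (DP.identityʳ _) (sym (DP.identityˡ _)))

  s₁s₂≡s₂s₁ : Commute s₁ s₂
  s₁s₂≡s₂s₁ = cong (true ,_) (trans (DP.identityʳ _) (sym (DP.identityˡ _)))

  s₀s₁≡ρ : s₀ ∙ s₁ ≡ (false , rot 1)
  s₀s₁≡ρ = cong (false ,_) s∙sρ≡ρ

  ⟨s₀,s₁⟩ : Pred (Carrier (G₁ n)) 0ℓ
  ⟨s₀,s₁⟩ = ⟨ G₁ n ⟩ (s₀ ∷ s₁ ∷ [])

  rotations∈⟨s₀,s₁⟩ : ∀ d → ⟨s₀,s₁⟩ (false , d)
  rotations∈⟨s₀,s₁⟩ d = DP.span-least (unit , mul , inv) generators (generated-by-s-ρ d)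
    where
    generators : (_∈ refl-rot 0 ∷ rot 1 ∷ []) ⊆ (λ d → ⟨s₀,s₁⟩ (false , d))
    generators (here refl) = gen₀
    generators (there (here refl)) = subst ⟨s₀,s₁⟩ s₀s₁≡ρ (mul gen₀ gen₁)

  ⟨s₀,s₁⟩⊆rotations : ∀ {x} → ⟨s₀,s₁⟩ x → proj₁ x ≡ false
  ⟨s₀,s₁⟩⊆rotations = span-least (refl , (λ p q → cong₂ _xor_ p q) , (λ p → p)) generators
    where
    generators : (_∈ s₀ ∷ s₁ ∷ []) ⊆ (λ x → proj₁ x ≡ false)
    generators (here refl) = refl
    generators (there (here refl)) = refl

  generates₁ : ∀ x → ⟨ G₁ n ⟩ (s₀ ∷ s₁ ∷ s₂ ∷ []) x
  generates₁ (false , d) = span-mono generators (rotations∈⟨s₀,s₁⟩ d)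
    where
    generators : (_∈ s₀ ∷ s₁ ∷ []) ⊆ ⟨ G₁ n ⟩ (s₀ ∷ s₁ ∷ s₂ ∷ [])
    generators (here refl) = gen₀
    generators (there (here refl)) = gen₁
  generates₁ (true , d) = subst (⟨ G₁ n ⟩ _) (cong (true ,_) (DP.identityˡ d)) (mul gen₂ (generates₁ (false , d)))

  ρ²≢ε : ¬ (false , rot 2) ≡ e
  ρ²≢ε eq = rot-≢ε (s≤s z≤n) 3≤n (cong proj₂ eq)

  ρ^-pair : ∀ b k → (b , rot 1) ^ᴳ k ≡ (_^_ Z₂ b k , rot k)
  ρ^-pair b k = trans (^-pair (b , rot 1) k) (cong (_^_ Z₂ b k ,_) (ρ^ k))

  s₀≢s₂ : ¬ s₀ ≡ s₂
  s₀≢s₂ ()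

  s₁≢s₂ : ¬ s₁ ≡ s₂
  s₁≢s₂ ()

  s₀s₁≢s₂ : ¬ s₀ ∙ s₁ ≡ s₂
  s₀s₁≢s₂ ()

  [s₀s₁]²≡ρ² : (s₀ ∙ s₁) ∙ (s₀ ∙ s₁) ≡ (false , rot 2)
  [s₀s₁]²≡ρ² = trans (cong₂ _∙_ s₀s₁≡ρ s₀s₁≡ρ) (cong (false ,_) (rot-+ 1 1))

  [s₀s₁]²≢ε : ¬ (s₀ ∙ s₁) ∙ (s₀ ∙ s₁) ≡ e
  [s₀s₁]²≢ε t²≡ε = ρ²≢ε (trans (sym [s₀s₁]²≡ρ²) t²≡ε)

  [s₀s₁]²≢s₂ : ¬ (s₀ ∙ s₁) ∙ (s₀ ∙ s₁) ≡ s₂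
  [s₀s₁]²≢s₂ t²≡s₂ with trans (sym [s₀s₁]²≡ρ²) t²≡s₂
  ... | ()

  module M₁ = CommutingInvolutionHypermap inv₀ inv₁ inv₂ s₀≢s₁ s₀≢s₂ s₁≢s₂ s₀s₂≡s₂s₀ s₁s₂≡s₂s₁ generates₁
                s₀s₁≢s₂ [s₀s₁]²≢ε [s₀s₁]²≢s₂

  M₁-orientable : Orientable (G₁ n) s₀ s₁ s₂
  M₁-orientable everything with span-least diagonal-isSubgroup generators (everything s₂)
    where
    Diagonal : Pred (Carrier (G₁ n)) 0ℓ
    Diagonal x = proj₁ x ≡ proj₁ (proj₂ x)
    diagonal-isSubgroup : IsSubgroup Diagonal
    diagonal-isSubgroup = refl , (λ p q → cong₂ _xor_ p q) , (λ p → p)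
    generators : (_∈ s₀ ∙ s₂ ∷ s₁ ∙ s₂ ∷ []) ⊆ Diagonal
    generators (here refl) = refl
    generators (there (here refl)) = refl
  ... | ()

  |s₀s₁|≡n : HasOrder (G₁ n) (s₀ ∙ s₁) n
  |s₀s₁|≡n = subst (λ t → HasOrder (G₁ n) t n) (sym s₀s₁≡ρ)
    (0<n , trans (ρ^-pair false n) (cong₂ _,_ (FinGroupProperties.ε^ Z₂ n) rot-n) , minimal)
    where
    minimal : ∀ j → 0 < j → j < n → ¬ (false , rot 1) ^ᴳ j ≡ e
    minimal j 0<j j<n ρʲ≡ε = rot-≢ε 0<j j<n (cong proj₂ (trans (sym (ρ^-pair false j)) ρʲ≡ε))

  |⟨s₀,s₁⟩|≡2n : HasSize (G₁ n) ⟨s₀,s₁⟩ (2 * n)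
  |⟨s₀,s₁⟩|≡2n = map (false ,_) D.elements , Unique.map⁺ (cong proj₂) D.unique , (λ x → listed x , spanned x)
               , trans (length-map _ D.elements) order-D₂ₙ
    where
    listed : ∀ x → ⟨s₀,s₁⟩ x → x ∈ map (false ,_) D.elements
    listed (b , d) f with ⟨s₀,s₁⟩⊆rotations f
    ... | refl = ∈-map⁺ (false ,_) (D.complete d)
    spanned : ∀ x → x ∈ map (false ,_) D.elements → ⟨s₀,s₁⟩ x
    spanned x x∈ with ∈-map⁻ (false ,_) x∈
    ... | d , _ , refl = rotations∈⟨s₀,s₁⟩ d

  n*4≡|G₁| : n * 4 ≡ order (G₁ n)
  n*4≡|G₁| = trans (*-comm n 4) (sym order-G₁)

  M₁-sequence : HasMSequence (G₁ n) s₀ s₁ s₂ 0 2 2 n n n 2 (4 * n)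
  M₁-sequence = record
    { type-k = M₁.|r₁r₂|≡2 ; type-m = M₁.|r₀r₂|≡2 ; type-n = |s₀s₁|≡n
    ; vertices = 4 , M₁.|H|≡4 , n*4≡|G₁|
    ; hyperedges = 4 , M₁.|K|≡4 , n*4≡|G₁|
    ; hyperfaces = 2 * n , |⟨s₀,s₁⟩|≡2n , trans (sym (*-assoc 2 2 n)) (sym order-G₁)
    ; flags = order-G₁
    ; genus = inj₁ (M₁-orientable , +-*-Solver.solve 1 (λ n → con 2 :* (n :+ n :+ con 2) :+ con 4 :* con 0 := con 4 :+ con 4 :* n) refl n) }

  s₁′ : Carrier (G₁ n)
  s₁′ = s₁ ∙ s₂

  inv₁′ : Involution (G₁ n) s₁′
  inv₁′ = (λ ()) , CommutingInvolutions.product-involution {s₁} {s₂} (proj₂ inv₁) (proj₂ inv₂) s₁s₂≡s₂s₁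

  s₀≢s₁′ : ¬ s₀ ≡ s₁′
  s₀≢s₁′ ()

  s₁′≢s₂ : ¬ s₁′ ≡ s₂
  s₁′≢s₂ ()

  s₁′s₂≡s₂s₁′ : Commute s₁′ s₂
  s₁′s₂≡s₂s₁′ = sym (commute-∙ {s₂} {s₁} {s₂} (sym s₁s₂≡s₂s₁) refl)

  generates₂ : ∀ x → ⟨ G₁ n ⟩ (s₀ ∷ s₁′ ∷ s₂ ∷ []) x
  generates₂ x = span-mono generators (generates₁ x)
    where
    generators : (_∈ s₀ ∷ s₁ ∷ s₂ ∷ []) ⊆ ⟨ G₁ n ⟩ (s₀ ∷ s₁′ ∷ s₂ ∷ [])
    generators (here refl) = gen₀
    generators (there (here refl)) = subst (⟨ G₁ n ⟩ (s₀ ∷ s₁′ ∷ s₂ ∷ [])) (involution-cancelʳ {s₂} (proj₂ inv₂) s₁) (mul gen₁ gen₂)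
    generators (there (there (here refl))) = gen₂

  s₀s₁′≡s₂ρ : s₀ ∙ s₁′ ≡ (true , rot 1)
  s₀s₁′≡s₂ρ = cong (true ,_) (trans (cong (refl-rot 0 D.∙_) (DP.identityʳ _)) s∙sρ≡ρ)

  s₀s₁′≢s₂ : ¬ s₀ ∙ s₁′ ≡ s₂
  s₀s₁′≢s₂ t≡s₂ = rot-≢ 1<n 0<n (λ ()) (cong proj₂ (trans (sym s₀s₁′≡s₂ρ) t≡s₂))

  [s₀s₁′]²≡ρ² : (s₀ ∙ s₁′) ∙ (s₀ ∙ s₁′) ≡ (false , rot 2)
  [s₀s₁′]²≡ρ² = trans (cong₂ _∙_ s₀s₁′≡s₂ρ s₀s₁′≡s₂ρ) (cong (false ,_) (rot-+ 1 1))

  [s₀s₁′]²≢ε : ¬ (s₀ ∙ s₁′) ∙ (s₀ ∙ s₁′) ≡ e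
  [s₀s₁′]²≢ε t²≡ε = ρ²≢ε (trans (sym [s₀s₁′]²≡ρ²) t²≡ε)

  [s₀s₁′]²≢s₂ : ¬ (s₀ ∙ s₁′) ∙ (s₀ ∙ s₁′) ≡ s₂
  [s₀s₁′]²≢s₂ t²≡s₂ with trans (sym [s₀s₁′]²≡ρ²) t²≡s₂
  ... | ()

  module M₂ = CommutingInvolutionHypermap inv₀ inv₁′ inv₂ s₀≢s₁′ s₀≢s₂ s₁′≢s₂ s₀s₂≡s₂s₀ s₁′s₂≡s₂s₁′ generates₂
                s₀s₁′≢s₂ [s₀s₁′]²≢ε [s₀s₁′]²≢s₂

  module Odd (odd : ¬ 2 ∣ n) where

    s₂≡[s₀s₁′]ⁿ : s₂ ≡ (s₀ ∙ s₁′) ^ᴳ n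
    s₂≡[s₀s₁′]ⁿ = sym (trans (cong (_^ᴳ n) s₀s₁′≡s₂ρ) (trans (ρ^-pair true n) (cong₂ _,_ (Z₂-true-^-odd n odd) rot-n)))

    |s₀s₁′|≡2n : HasOrder (G₁ n) (s₀ ∙ s₁′) (2 * n)
    |s₀s₁′|≡2n = subst (λ t → HasOrder (G₁ n) t (2 * n)) (sym s₀s₁′≡s₂ρ)
      (≤-trans 0<n (m≤m+n n _) , trans (ρ^-pair true (2 * n)) (cong₂ _,_ (Z₂-^-even true (2 * n) (divides n (*-comm 2 n))) (rot-* 2))
      , minimal)
      where
      minimal : ∀ j → 0 < j → j < 2 * n → ¬ (true , rot 1) ^ᴳ j ≡ e
      minimal j 0<j j<2n ρʲ≡ε with <-cmp j n | trans (sym (ρ^-pair true j)) ρʲ≡ε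
      ... | tri< j<n _ _ | eq = rot-≢ε 0<j j<n (cong proj₂ eq)
      ... | tri≈ _ refl _ | eq with trans (sym (Z₂-true-^-odd j odd)) (cong proj₁ eq)
      ...   | ()
      minimal j 0<j j<2n ρʲ≡ε | tri> _ _ n<j | eq =
        rot-≢ε (m<n⇒0<n∸m n<j) (+-cancelʳ-< n (j ∸ n) n j∸n+n<n+n) (trans (sym (rot-+n (j ∸ n))) (trans (cong rot j∸n+n≡j) (cong proj₂ eq)))
        where
        j∸n+n≡j : j ∸ n + n ≡ j
        j∸n+n≡j = m∸n+n≡m (<⇒≤ n<j)
        j∸n+n<n+n : j ∸ n + n < n + n
        j∸n+n<n+n = subst₂ _<_ (sym j∸n+n≡j) (cong (n +_) (+-identityʳ n)) j<2n

    open InvolutionPowerOfProduct (proj₂ inv₂) s₁′s₂≡s₂s₁′ generates₂ n s₂≡[s₀s₁′]ⁿ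

    M₂-nonOrientable : NonOrientable (G₁ n) s₀ s₁′ s₂
    M₂-nonOrientable = ⟨r₀r₂,r₁r₂⟩-full

    M₂-sequence : HasMSequence (G₁ n) s₀ s₁′ s₂ 1 2 2 (2 * n) n n 1 (4 * n)
    M₂-sequence = record
      { type-k = M₂.|r₁r₂|≡2 ; type-m = M₂.|r₀r₂|≡2 ; type-n = |s₀s₁′|≡2n
      ; vertices = 4 , M₂.|H|≡4 , n*4≡|G₁|
      ; hyperedges = 4 , M₂.|K|≡4 , n*4≡|G₁|
      ; hyperfaces = order (G₁ n) , full-size ⟨r₀,r₁⟩-full , *-identityˡ _
      ; flags = order-G₁
      ; genus = inj₂ (M₂-nonOrientable , +-*-Solver.solve 1 (λ n → con 2 :* (n :+ n :+ con 1) :+ con 2 :* con 1 := con 4 :+ con 4 :* n) refl n) }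

    M₂≅M₃ : ∀ m .{{_ : NonZero m}} → 2 * n ≡ m →
            G₁ n ≅ G₂ m × HypermapIso (G₁ n) s₀ s₁′ s₂ (G₂ m) (r₀² m) (r₁² m) (r₂² m)
    M₂≅M₃ _ refl = G≅G₂ , M≅M₃
      where
      open CentralHypermap.PowerOfTCase M₂.regularLinearHypermap s₀s₂≡s₂s₀ s₁′s₂≡s₂s₁′ |s₀s₁′|≡2n n s₂≡[s₀s₁′]ⁿ

module G₂Hypermap (m : ℕ) .{{_ : NonZero m}} (6≤m : 6 ≤ m) (2∣m : 2 ∣ m) where
  open FinGroup (G₂ m) hiding (Carrier; ε; order)
  open FinGroup (G₂ m) using () renaming (ε to e)
  open FinGroupProperties (G₂ m)
  open Dihedral m using (rot; refl-rot; fromℕn; -z_; _+z_)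
  open DihedralProperties m using (rot-+; rot-≢; rot-≢ε; rot-n; ρ^; s∙sρ≡ρ; reflection-involution;
                                   generated-by-s-ρ; order-D₂ₙ; toℕ-fromℕn)
  private
    module ℤₘ = AbelianGroup (Zmod.abelianGroup m)
  open ≡-Reasoning

  h : ℕ
  h = m / 2

  h+h≡m : h + h ≡ m
  h+h≡m = trans (cong (h +_) (sym (+-identityʳ h))) (m*[n/m]≡n 2∣m)

  3≤h : 3 ≤ h
  3≤h = *-cancelˡ-≤ 2 (subst (6 ≤_) (sym (m*[n/m]≡n 2∣m)) 6≤m)

  private
    0<h : 0 < h
    0<h = ≤-trans (s≤s z≤n) 3≤h

    h<m : h < m
    h<m = subst (h <_) h+h≡m (m<m+n h 0<h)

    1<m : 1 < m
    1<m = ≤-trans (s≤s (s≤s z≤n)) (≤-trans 3≤h (<⇒≤ h<m))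

    2<m : 2 < m
    2<m = ≤-trans 3≤h (<⇒≤ h<m)

  s₀ s₁ s₂ : Carrier (G₂ m)
  s₀ = r₀² m
  s₁ = r₁² m
  s₂ = r₂² m

  inv₀ : Involution (G₂ m) s₀
  inv₀ = (λ ()) , reflection-involution _

  inv₁ : Involution (G₂ m) s₁
  inv₁ = (λ ()) , reflection-involution _

  inv₂ : Involution (G₂ m) s₂
  inv₂ = rot-≢ε 0<h h<m , trans (rot-+ h h) (trans (cong rot h+h≡m) rot-n)

  s₀≢s₁ : ¬ s₀ ≡ s₁
  s₀≢s₁ eq = rot-≢ (≤-trans (s≤s z≤n) 1<m) 1<m (λ ()) (cong (λ x → false , proj₂ x) eq)

  s₀≢s₂ : ¬ s₀ ≡ s₂
  s₀≢s₂ ()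

  s₁≢s₂ : ¬ s₁ ≡ s₂
  s₁≢s₂ ()

  -- ρ^h is central because ρ^{-h} = ρ^h.
  reflection-commutes-with-s₂ : ∀ i → Commute (true , i) s₂
  reflection-commutes-with-s₂ i = cong (true ,_) (trans (ℤₘ.comm i _) (cong (_+z i) (sym -h≡h)))
    where
    -h≡h : -z (fromℕn h) ≡ fromℕn h
    -h≡h = cong fromℕn (begin
      m ∸ toℕ (fromℕn h)   ≡⟨ cong (m ∸_) (trans (toℕ-fromℕn h) (m<n⇒m%n≡m h<m)) ⟩
      m ∸ h                ≡⟨ cong (_∸ h) (sym h+h≡m) ⟩
      h + h ∸ h            ≡⟨ m+n∸n≡m h h ⟩
      h                    ∎)

  generates₃ : ∀ x → ⟨ G₂ m ⟩ (s₀ ∷ s₁ ∷ s₂ ∷ []) x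
  generates₃ x = span-mono generators (generated-by-s-ρ x)
    where
    generators : (_∈ refl-rot 0 ∷ rot 1 ∷ []) ⊆ ⟨ G₂ m ⟩ (s₀ ∷ s₁ ∷ s₂ ∷ [])
    generators (here refl) = gen₀
    generators (there (here refl)) = subst (⟨ G₂ m ⟩ (s₀ ∷ s₁ ∷ s₂ ∷ [])) s∙sρ≡ρ (mul gen₀ gen₁)

  [s₀s₁]²≡ρ² : (s₀ ∙ s₁) ∙ (s₀ ∙ s₁) ≡ rot 2
  [s₀s₁]²≡ρ² = trans (cong₂ _∙_ s∙sρ≡ρ s∙sρ≡ρ) (rot-+ 1 1)

  s₀s₁≢s₂ : ¬ s₀ ∙ s₁ ≡ s₂
  s₀s₁≢s₂ t≡s₂ = rot-≢ 1<m h<m (<⇒≢ (≤-trans (s≤s (s≤s z≤n)) 3≤h)) (trans (sym s∙sρ≡ρ) t≡s₂)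

  [s₀s₁]²≢ε : ¬ (s₀ ∙ s₁) ∙ (s₀ ∙ s₁) ≡ e
  [s₀s₁]²≢ε t²≡ε = rot-≢ε (s≤s z≤n) 2<m (trans (sym [s₀s₁]²≡ρ²) t²≡ε)

  [s₀s₁]²≢s₂ : ¬ (s₀ ∙ s₁) ∙ (s₀ ∙ s₁) ≡ s₂
  [s₀s₁]²≢s₂ t²≡s₂ = rot-≢ 2<m h<m (<⇒≢ 3≤h) (trans (sym [s₀s₁]²≡ρ²) t²≡s₂)

  module M₃ = CommutingInvolutionHypermap inv₀ inv₁ inv₂ s₀≢s₁ s₀≢s₂ s₁≢s₂
                (reflection-commutes-with-s₂ _) (reflection-commutes-with-s₂ _) generates₃
                s₀s₁≢s₂ [s₀s₁]²≢ε [s₀s₁]²≢s₂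

  |s₀s₁|≡m : HasOrder (G₂ m) (s₀ ∙ s₁) m
  |s₀s₁|≡m = subst (λ t → HasOrder (G₂ m) t m) (sym s∙sρ≡ρ) (≤-trans (s≤s z≤n) 1<m , trans (ρ^ m) rot-n , minimal)
    where
    minimal : ∀ j → 0 < j → j < m → ¬ rot 1 ^ᴳ j ≡ e
    minimal j 0<j j<m ρʲ≡ε = rot-≢ε 0<j j<m (trans (sym (ρ^ j)) ρʲ≡ε)

  s₂≡[s₀s₁]ʰ : s₂ ≡ (s₀ ∙ s₁) ^ᴳ h
  s₂≡[s₀s₁]ʰ = sym (trans (cong (_^ᴳ h) s∙sρ≡ρ) (ρ^ h))

  open InvolutionPowerOfProduct (proj₂ inv₂) (reflection-commutes-with-s₂ _) generates₃ h s₂≡[s₀s₁]ʰ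

  M₃-nonOrientable : NonOrientable (G₂ m) s₀ s₁ s₂
  M₃-nonOrientable = ⟨r₀r₂,r₁r₂⟩-full

  M₃-sequence : HasMSequence (G₂ m) s₀ s₁ s₂ 1 2 2 m h h 1 (2 * m)
  M₃-sequence = record
    { type-k = M₃.|r₁r₂|≡2 ; type-m = M₃.|r₀r₂|≡2 ; type-n = |s₀s₁|≡m
    ; vertices = 4 , M₃.|H|≡4 , h*4≡|G₂|
    ; hyperedges = 4 , M₃.|K|≡4 , h*4≡|G₂|
    ; hyperfaces = order (G₂ m) , full-size ⟨r₀,r₁⟩-full , *-identityˡ _
    ; flags = order-D₂ₙ
    ; genus = inj₂ (M₃-nonOrientable , euler) }
    where
    h*4≡|G₂| : h * 4 ≡ order (G₂ m)
    h*4≡|G₂| = trans (+-*-Solver.solve 1 (λ h → h :* con 4 := con 2 :* (h :+ h)) refl h)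
                     (trans (cong (2 *_) h+h≡m) (sym order-D₂ₙ))
    euler : 2 * (h + h + 1) + 2 * 1 ≡ 4 + 2 * m
    euler = trans (+-*-Solver.solve 1 (λ h → con 2 :* (h :+ h :+ con 1) :+ con 2 :* con 1 := con 4 :+ con 2 :* (h :+ h)) refl h)
                  (cong (λ k → 4 + 2 * k) h+h≡m)

classify-core-⟨r₂⟩ : ∀ {G r₀ r₁ r₂} → RegularLinearHypermap G r₀ r₁ r₂ →
                     IsCore G (⟨ G ⟩ (r₁ ∷ r₂ ∷ [])) (⟨ G ⟩ (r₂ ∷ [])) → CentralClassification G r₀ r₁ r₂
classify-core-⟨r₂⟩ M core = classify-central M (proj₁ commutes) (proj₂ commutes)
  where
  commutes = RegularLinearHypermapProperties.core≡Z⇒commute M core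

n<2*n : ∀ n .{{_ : NonZero n}} → n < 2 * n
n<2*n n = m<m+n n (subst (0 <_) (sym (+-identityʳ n)) (>-nonZero⁻¹ n))

core-classification : ∀ (G : FinGroup) (r₀ r₁ r₂ : Carrier G) → RegularLinearHypermap G r₀ r₁ r₂ →
    IsCore G (⟨ G ⟩ (r₁ ∷ r₂ ∷ [])) (𝟏 G)
  ⊎ (IsCore G (⟨ G ⟩ (r₁ ∷ r₂ ∷ [])) (⟨ G ⟩ (r₂ ∷ []))
     × ((Σ ℕ λ n → Σ (NonZero n) λ nz → 3 ≤ n × (G ≅ G₁ n {{nz}}))
       ⊎ (Σ ℕ λ m → Σ (NonZero m) λ nz → 2 ∣ m × 6 ≤ m × (G ≅ G₂ m {{nz}}))))
core-classification G r₀ r₁ r₂ M with (FinGroup._∙_ G r₀ r₂ ≟ FinGroup._∙_ G r₂ r₀) ×-dec (FinGroup._∙_ G r₁ r₂ ≟ FinGroup._∙_ G r₂ r₁)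
  where open FinGroup G using (_≟_)
... | no not-central = inj₁ (core≡1 not-central)
  where open RegularLinearHypermapProperties M
... | yes (r₀r₂≡r₂r₀ , r₁r₂≡r₂r₁) = inj₂ (core≡Z (r₂-central r₀r₂≡r₂r₀ r₁r₂≡r₂r₁) , group (classify-central M r₀r₂≡r₂r₀ r₁r₂≡r₂r₁))
  where
  open RegularLinearHypermapProperties M
  group : CentralClassification G r₀ r₁ r₂ →
          (Σ ℕ λ n → Σ (NonZero n) λ nz → 3 ≤ n × (G ≅ G₁ n {{nz}}))
        ⊎ (Σ ℕ λ m → Σ (NonZero m) λ nz → 2 ∣ m × 6 ≤ m × (G ≅ G₂ m {{nz}}))
  group (type-G₁ n {{nz}} 3≤n G≅G₁ _) = inj₁ (n , nz , 3≤n , G≅G₁)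
  group (type-G₂ m {{nz}} 2∣m 6≤m G≅G₂ _) = inj₂ (m , nz , 2∣m , 6≤m , G≅G₂)

G₁≅G₂-odd : ∀ (n m : ℕ) .{{_ : NonZero n}} .{{_ : NonZero m}} → 3 ≤ n → 2 * n ≡ m → ¬ (2 ∣ n) → G₁ n ≅ G₂ m
G₁≅G₂-odd n m 3≤n 2n≡m odd = proj₁ (G₁Hypermaps.Odd.M₂≅M₃ n 3≤n odd m 2n≡m)

M₁-transport : ∀ {G r₀ r₁ r₂ n n′} .{{_ : NonZero n}} .{{_ : NonZero n′}} → n′ ≡ n →
               HypermapIso G r₀ r₁ r₂ (G₁ n′) (r₀¹ n′) (r₁¹ n′) (r₂¹ n′) →
               HypermapIso G r₀ r₁ r₂ (G₁ n) (r₀¹ n) (r₁¹ n) (r₂¹ n)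
M₁-transport refl M≅M₁ = M≅M₁

M₃-transport : ∀ {G r₀ r₁ r₂ m m′} .{{_ : NonZero m}} .{{_ : NonZero m′}} → m′ ≡ m →
               HypermapIso G r₀ r₁ r₂ (G₂ m′) (r₀² m′) (r₁² m′) (r₂² m′) →
               HypermapIso G r₀ r₁ r₂ (G₂ m) (r₀² m) (r₁² m) (r₂² m)
M₃-transport refl M≅M₃ = M≅M₃

M₁-unique-even : ∀ (n : ℕ) .{{_ : NonZero n}} → 3 ≤ n → 2 ∣ n →
                 ∀ (G : FinGroup) (r₀ r₁ r₂ : Carrier G) → RegularLinearHypermap G r₀ r₁ r₂ →
                 IsCore G (⟨ G ⟩ (r₁ ∷ r₂ ∷ [])) (⟨ G ⟩ (r₂ ∷ [])) → G ≅ G₁ n →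
                 HypermapIso G r₀ r₁ r₂ (G₁ n) (r₀¹ n) (r₁¹ n) (r₂¹ n)
M₁-unique-even n _ 2∣n G r₀ r₁ r₂ M core G≅G₁ = from-classification (classify-core-⟨r₂⟩ M core)
  where
  from-classification : CentralClassification G r₀ r₁ r₂ → HypermapIso G r₀ r₁ r₂ (G₁ n) (r₀¹ n) (r₁¹ n) (r₂¹ n)
  from-classification (type-G₁ _ _ G≅G₁′ M≅M₁) = M₁-transport (≅G₁-unique G≅G₁′ G≅G₁) M≅M₁
  from-classification (type-G₂ m _ _ G≅G₂ _) =
    ⊥-elim (G₂≇G₁ 2∣n (subst (n <_) (sym (≅G₂-≅G₁-order G≅G₂ G≅G₁)) (n<2*n n)) (≅-trans (≅-sym G≅G₂) G≅G₁))

M₁-or-M₂-odd : ∀ (n : ℕ) .{{_ : NonZero n}} → 3 ≤ n → ¬ (2 ∣ n) →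
               ∀ (G : FinGroup) (r₀ r₁ r₂ : Carrier G) → RegularLinearHypermap G r₀ r₁ r₂ →
               IsCore G (⟨ G ⟩ (r₁ ∷ r₂ ∷ [])) (⟨ G ⟩ (r₂ ∷ [])) → G ≅ G₁ n →
                 HypermapIso G r₀ r₁ r₂ (G₁ n) (r₀¹ n) (r₁¹ n) (r₂¹ n)
               ⊎ HypermapIso G r₀ r₁ r₂ (G₁ n) (r₀¹ n) (FinGroup._∙_ (G₁ n) (r₁¹ n) (r₂¹ n)) (r₂¹ n)
M₁-or-M₂-odd n 3≤n odd G r₀ r₁ r₂ M core G≅G₁ = from-classification (classify-core-⟨r₂⟩ M core)
  where
  from-classification : CentralClassification G r₀ r₁ r₂ →
                          HypermapIso G r₀ r₁ r₂ (G₁ n) (r₀¹ n) (r₁¹ n) (r₂¹ n)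
                        ⊎ HypermapIso G r₀ r₁ r₂ (G₁ n) (r₀¹ n) (FinGroup._∙_ (G₁ n) (r₁¹ n) (r₂¹ n)) (r₂¹ n)
  from-classification (type-G₁ _ _ G≅G₁′ M≅M₁) = inj₁ (M₁-transport (≅G₁-unique G≅G₁′ G≅G₁) M≅M₁)
  from-classification (type-G₂ m _ _ G≅G₂ M≅M₃) =
    inj₂ (HypermapIso-trans M≅M₃ (HypermapIso-sym (proj₂ (G₁Hypermaps.Odd.M₂≅M₃ n 3≤n odd m 2n≡m))))
    where
    2n≡m : 2 * n ≡ m
    2n≡m = sym (≅G₂-≅G₁-order G≅G₂ G≅G₁)

M₃-unique : ∀ (m : ℕ) .{{_ : NonZero m}} → 6 ≤ m → 4 ∣ m →
            ∀ (G : FinGroup) (r₀ r₁ r₂ : Carrier G) → RegularLinearHypermap G r₀ r₁ r₂ →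
            IsCore G (⟨ G ⟩ (r₁ ∷ r₂ ∷ [])) (⟨ G ⟩ (r₂ ∷ [])) → G ≅ G₂ m →
            HypermapIso G r₀ r₁ r₂ (G₂ m) (r₀² m) (r₁² m) (r₂² m)
M₃-unique m _ 4∣m G r₀ r₁ r₂ M core G≅G₂ = from-classification (classify-core-⟨r₂⟩ M core)
  where
  from-classification : CentralClassification G r₀ r₁ r₂ → HypermapIso G r₀ r₁ r₂ (G₂ m) (r₀² m) (r₁² m) (r₂² m)
  from-classification (type-G₂ _ _ _ G≅G₂′ M≅M₃) = M₃-transport (≅G₂-unique G≅G₂′ G≅G₂) M≅M₃
  from-classification (type-G₁ n _ G≅G₁ _) =
    ⊥-elim (G₂≇G₁ 2∣n (subst (n <_) (sym m≡2n) (n<2*n n)) (≅-trans (≅-sym G≅G₂) G≅G₁))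
    where
    m≡2n : m ≡ 2 * n
    m≡2n = ≅G₂-≅G₁-order G≅G₂ G≅G₁
    2∣n : 2 ∣ n
    2∣n = *-cancelˡ-∣ 2 (subst (4 ∣_) m≡2n 4∣m)

M₁-facts : ∀ (n : ℕ) .{{_ : NonZero n}} → 3 ≤ n →
           RegularLinearHypermap (G₁ n) (r₀¹ n) (r₁¹ n) (r₂¹ n)
           × Orientable (G₁ n) (r₀¹ n) (r₁¹ n) (r₂¹ n)
           × HasMSequence (G₁ n) (r₀¹ n) (r₁¹ n) (r₂¹ n) 0 2 2 n n n 2 (4 * n)
M₁-facts n 3≤n = M₁.regularLinearHypermap , M₁-orientable , M₁-sequence
  where open G₁Hypermaps n 3≤n

M₂-facts : ∀ (n : ℕ) .{{_ : NonZero n}} → 3 ≤ n → ¬ (2 ∣ n) →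
           RegularLinearHypermap (G₁ n) (r₀¹ n) (FinGroup._∙_ (G₁ n) (r₁¹ n) (r₂¹ n)) (r₂¹ n)
           × NonOrientable (G₁ n) (r₀¹ n) (FinGroup._∙_ (G₁ n) (r₁¹ n) (r₂¹ n)) (r₂¹ n)
           × HasMSequence (G₁ n) (r₀¹ n) (FinGroup._∙_ (G₁ n) (r₁¹ n) (r₂¹ n)) (r₂¹ n) 1 2 2 (2 * n) n n 1 (4 * n)
M₂-facts n 3≤n odd = M₂.regularLinearHypermap , M₂-nonOrientable , M₂-sequence
  where
  open G₁Hypermaps n 3≤n
  open Odd odd

M₃-facts : ∀ (m : ℕ) .{{_ : NonZero m}} → 6 ≤ m → 2 ∣ m →
           RegularLinearHypermap (G₂ m) (r₀² m) (r₁² m) (r₂² m)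
           × NonOrientable (G₂ m) (r₀² m) (r₁² m) (r₂² m)
           × HasMSequence (G₂ m) (r₀² m) (r₁² m) (r₂² m) 1 2 2 m (m / 2) (m / 2) 1 (2 * m)
M₃-facts m 6≤m 2∣m = M₃.regularLinearHypermap , M₃-nonOrientable , M₃-sequence
  where open G₂Hypermap m 6≤m 2∣m

theorem3p10 :
  -- Part 1: Core_G(⟨r₁,r₂⟩) = 1, or = ⟨r₂⟩ and G ≅ G₁ (n ≥ 3) or G ≅ G₂ (m even, m ≥ 6)
  (∀ (G : FinGroup) (r₀ r₁ r₂ : Carrier G) → RegularLinearHypermap G r₀ r₁ r₂ →
      IsCore G (⟨ G ⟩ (r₁ ∷ r₂ ∷ [])) (𝟏 G)
    ⊎ (IsCore G (⟨ G ⟩ (r₁ ∷ r₂ ∷ [])) (⟨ G ⟩ (r₂ ∷ []))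
       × ((Σ ℕ λ n → Σ (NonZero n) λ nz → 3 ≤ n × (G ≅ G₁ n {{nz}}))
         ⊎ (Σ ℕ λ m → Σ (NonZero m) λ nz → 2 ∣ m × 6 ≤ m × (G ≅ G₂ m {{nz}})))))
  -- Part 2: if 2n = m and n is odd then G₁ ≅ G₂
  × (∀ (n m : ℕ) .{{_ : NonZero n}} .{{_ : NonZero m}} → 3 ≤ n → 2 * n ≡ m → ¬ (2 ∣ n) →
      G₁ n ≅ G₂ m)
  -- Part 3: n even: every regular linear hypermap in case (2) with automorphism group G₁ is ≅ 𝓜₁
  × (∀ (n : ℕ) .{{_ : NonZero n}} → 3 ≤ n → 2 ∣ n →
      ∀ (G : FinGroup) (r₀ r₁ r₂ : Carrier G) → RegularLinearHypermap G r₀ r₁ r₂ →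
      IsCore G (⟨ G ⟩ (r₁ ∷ r₂ ∷ [])) (⟨ G ⟩ (r₂ ∷ [])) → G ≅ G₁ n →
      HypermapIso G r₀ r₁ r₂ (G₁ n) (r₀¹ n) (r₁¹ n) (r₂¹ n))
  -- Part 4: n odd: ... is ≅ 𝓜₁ or 𝓜₂ = 𝓜(G₁; r₀, r₁r₂, r₂)
  × (∀ (n : ℕ) .{{_ : NonZero n}} → 3 ≤ n → ¬ (2 ∣ n) →
      ∀ (G : FinGroup) (r₀ r₁ r₂ : Carrier G) → RegularLinearHypermap G r₀ r₁ r₂ →
      IsCore G (⟨ G ⟩ (r₁ ∷ r₂ ∷ [])) (⟨ G ⟩ (r₂ ∷ [])) → G ≅ G₁ n →
        HypermapIso G r₀ r₁ r₂ (G₁ n) (r₀¹ n) (r₁¹ n) (r₂¹ n)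
      ⊎ HypermapIso G r₀ r₁ r₂ (G₁ n) (r₀¹ n) (FinGroup._∙_ (G₁ n) (r₁¹ n) (r₂¹ n)) (r₂¹ n))
  -- Part 5: 4 ∣ m: every regular linear hypermap in case (2) with automorphism group G₂ is ≅ 𝓜₃
  × (∀ (m : ℕ) .{{_ : NonZero m}} → 6 ≤ m → 4 ∣ m →
      ∀ (G : FinGroup) (r₀ r₁ r₂ : Carrier G) → RegularLinearHypermap G r₀ r₁ r₂ →
      IsCore G (⟨ G ⟩ (r₁ ∷ r₂ ∷ [])) (⟨ G ⟩ (r₂ ∷ [])) → G ≅ G₂ m →
      HypermapIso G r₀ r₁ r₂ (G₂ m) (r₀² m) (r₁² m) (r₂² m))
  -- Part 6: n even: 𝓜₁ is an orientable regular linear hypermap, [0;2,2,n;n,n,2;4n]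
  × (∀ (n : ℕ) .{{_ : NonZero n}} → 3 ≤ n → 2 ∣ n →
      RegularLinearHypermap (G₁ n) (r₀¹ n) (r₁¹ n) (r₂¹ n)
      × Orientable (G₁ n) (r₀¹ n) (r₁¹ n) (r₂¹ n)
      × HasMSequence (G₁ n) (r₀¹ n) (r₁¹ n) (r₂¹ n) 0 2 2 n n n 2 (4 * n))
  -- Part 7: n odd: 𝓜₁ has [0;2,2,n;n,n,2;4n]; 𝓜₂ has [1;2,2,2n;n,n,1;4n] and is
  -- non-orientable (on the projective plane)
  × (∀ (n : ℕ) .{{_ : NonZero n}} → 3 ≤ n → ¬ (2 ∣ n) →
      RegularLinearHypermap (G₁ n) (r₀¹ n) (r₁¹ n) (r₂¹ n)
      × HasMSequence (G₁ n) (r₀¹ n) (r₁¹ n) (r₂¹ n) 0 2 2 n n n 2 (4 * n)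
      × RegularLinearHypermap (G₁ n) (r₀¹ n) (FinGroup._∙_ (G₁ n) (r₁¹ n) (r₂¹ n)) (r₂¹ n)
      × NonOrientable (G₁ n) (r₀¹ n) (FinGroup._∙_ (G₁ n) (r₁¹ n) (r₂¹ n)) (r₂¹ n)
      × HasMSequence (G₁ n) (r₀¹ n) (FinGroup._∙_ (G₁ n) (r₁¹ n) (r₂¹ n)) (r₂¹ n)
          1 2 2 (2 * n) n n 1 (4 * n))
  -- Part 8: 𝓜₃ is a non-orientable regular linear hypermap (projective plane),
  -- [1;2,2,m;m/2,m/2,1;2m]
  × (∀ (m : ℕ) .{{_ : NonZero m}} → 6 ≤ m → 2 ∣ m →
      RegularLinearHypermap (G₂ m) (r₀² m) (r₁² m) (r₂² m)
      × NonOrientable (G₂ m) (r₀² m) (r₁² m) (r₂² m)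
      × HasMSequence (G₂ m) (r₀² m) (r₁² m) (r₂² m) 1 2 2 m (m / 2) (m / 2) 1 (2 * m))
theorem3p10 =
    core-classification
  , G₁≅G₂-odd
  , M₁-unique-even
  , M₁-or-M₂-odd
  , M₃-unique
  , (λ n 3≤n _ → M₁-facts n 3≤n)
  , (λ n 3≤n odd → proj₁ (M₁-facts n 3≤n) , proj₂ (proj₂ (M₁-facts n 3≤n)) , M₂-facts n 3≤n odd)
  , M₃-facts
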